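{- For every $n\ge 1$ the inclusions of sets of games $$\mathcal{W}_n^+ \subseteq \Pi_n \subseteq J_n^+$$ hold. The first inclusion is strict if and only if $n\ge 7$, and the second inclusion is strict if and only if $n\ge 6$.
   Context: Let $N=\{1,\dots,n\}$. A simple game on $N$ is a family $W$ of subsets of $N$ (the winning coalitions) with $N\in W$, $\emptyset\notin W$, and such that $S\in W$, $S\subseteq R\subseteq N$ imply $R\in W$. Partially order the subsets of $N$ (poset $M(n)$) as follows: writing $A=\{a_1>a_2>\dots>a_k\}$ and $B=\{b_1>\dots>b_j\}$, set $B\ge A$ iff $k\le j$ and $b_i\ge a_i$ for all $i\le k$. A linear game on $n$ voters is a simple game $v$ whose set of winning coalitions $W_v$ is an up-set of $M(n)$. $J_n$ is the set of all linear games on $n$ voters; the rank of $v\in J_n$ is the number of losing coalitions (subsets of $N$ not in $W_v$), and $J_n^+$ is the set of linear games of rank at least $2^{n-1}$. A game is proper if for no coalition $A$ are both $A$ and $N\setminus A$ winning; $\Pi_n$ is the set of proper linear games on $n$ voters. A linear game $v$ is weighted if there are weights $w_n\ge w_{n-1}\ge\dots\ge w_1\ge 0$ and a quota $q\in(0,\sum_i w_i]$ such that $A\in W_v$ iff $\sum_{i\in A}w_i\ge q$. $\mathcal{W}_n^+$ denotes the set of weighted games on $n$ voters of rank at least $2^{n-1}$.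
   Formalization: The weights and the quota defining a weighted game are rational numbers. -}

module Defs where

open import Data.Bool using (Bool; true; false; if_then_else_)
open import Data.Nat using (ℕ; zero; suc; _≤_; _∸_; _^_)
open import Data.Fin using (Fin; zero; suc; toℕ)
open import Data.Fin.Subset using (Subset; _⊆_; ∁; ⊤; ⊥)
open import Data.Vec using (Vec; []; _∷_)
open import Data.List using (List; []; _∷_; _++_; map; reverse)
open import Data.Nat.ListAction using (sum)
open import Data.Product using (_×_; ∃; Σ-syntax)
open import Data.Rational using (ℚ; 0ℚ; _+_) renaming (_≤_ to _≤ℚ_; _<_ to _<ℚ_)
open import Relation.Binary.PropositionalEquality using (_≡_)
open import Relation.Nullary using (¬_)
open import Function.Bundles using (_⇔_)
import Data.Unit as U
import Data.Empty as E

-- Voter i ∈ {1..n} is represented by (i-1) : Fin n; a coalition is a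
-- Subset n (= Vec Bool n).  A game is given by the characteristic
-- function of its family of winning coalitions.
Game : ℕ → Set
Game n = Subset n → Bool

Win : ∀ {n} → Game n → Subset n → Set
Win v S = v S ≡ true

allSubsets : (n : ℕ) → List (Subset n)
allSubsets zero = [] ∷ []
allSubsets (suc n) = map (true ∷_) (allSubsets n) ++ map (false ∷_) (allSubsets n)

members : ∀ {n} → Subset n → List ℕ
members [] = []
members (true ∷ p) = 0 ∷ map suc (members p)
members (false ∷ p) = map suc (members p)

desc : ∀ {n} → Subset n → List ℕ
desc p = reverse (members p)

Dom : List ℕ → List ℕ → Set
Dom [] bs = U.⊤
Dom (a ∷ as) [] = E.⊥
Dom (a ∷ as) (b ∷ bs) = (a ≤ b) × Dom as bs

_≥M_ : ∀ {n} → Subset n → Subset n → Set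
B ≥M A = Dom (desc A) (desc B)

IsSimple : ∀ {n} → Game n → Set
IsSimple {n} v = Win v ⊤ × ¬ Win v ⊥ ×
  (∀ S R → S ⊆ R → Win v S → Win v R)

IsLinear : ∀ {n} → Game n → Set
IsLinear {n} v = IsSimple v × (∀ A B → B ≥M A → Win v A → Win v B)

rank : ∀ {n} → Game n → ℕ
rank {n} v = sum (map (λ S → if v S then 0 else 1) (allSubsets n))

InJplus : ∀ n → Game n → Set
InJplus n v = IsLinear v × 2 ^ (n ∸ 1) ≤ rank v

IsProper : ∀ {n} → Game n → Set
IsProper v = ∀ A → ¬ (Win v A × Win v (∁ A))

InPi : ∀ n → Game n → Set
InPi n v = IsLinear v × IsProper v

weightOf : ∀ {n} → (Fin n → ℚ) → Subset n → ℚ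
weightOf w [] = 0ℚ
weightOf w (b ∷ A) = (if b then w zero else 0ℚ) + weightOf (λ i → w (suc i)) A

IsWeighted : ∀ {n} → Game n → Set
IsWeighted {n} v = IsLinear v ×
  (Σ[ w ∈ (Fin n → ℚ) ] Σ[ q ∈ ℚ ]
     ((∀ (i : Fin n) → toℕ i ≡ 0 → 0ℚ ≤ℚ w i) ×
      (∀ (i j : Fin n) → toℕ i ≤ toℕ j → w i ≤ℚ w j) ×
      0ℚ <ℚ q × q ≤ℚ weightOf w ⊤ ×
      (∀ A → Win v A ⇔ (q ≤ℚ weightOf w A))))

InWplus : ∀ n → Game n → Set
InWplus n v = IsWeighted v × 2 ^ (n ∸ 1) ≤ rank v

-- A ⊊ B for families of games on n voters, given A ⊆ B: some game in B not in A
StrictlyLarger : ∀ n → (Game n → Set) → (Game n → Set) → Set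
StrictlyLarger n A B = ∃ λ (v : Game n) → B v × ¬ A v

-- A proper game loses at least one coalition of every complementary pair {S, ∁ S}, so its rank is
-- at least 2^(n-1).  If a weighted game had complementary winners A and ∁ A, then
-- w(S) + w(∁ S) = w(A) + w(∁ A) ≥ 2q would put a winner in every pair, pushing the rank below
-- 2^(n-1); hence weighted games of rank ≥ 2^(n-1) are proper.  A dummy voter preserves linearity
-- and properness, doubles the rank and reflects weightedness, so counterexamples on 7 and 6 voters
-- propagate upwards.  Below these sizes, a pruned enumeration of all (proper) linear games is
-- checked against explicit integer weights, respectively against the rank bound.
module Submission where

open import Defs
open import Algebra.Bundles using (CommutativeMonoid)
import Algebra.Properties.CommutativeSemigroup as CommSemigroupProperties
open import Data.Bool using (Bool; true; false; if_then_else_; _∧_; _∨_; not; T)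
open import Data.Bool.ListAction using (all; any)
open import Data.Bool.Properties using (T-≡; T-∧; T-∨) renaming (_≟_ to _≟ᵇ_)
open import Data.Empty using (⊥-elim)
open import Data.Fin using (Fin; zero; suc; toℕ)
import Data.Fin.Properties as Fin
open import Data.Fin.Subset using (Subset; _⊆_; ∁; ⊤; ⊥; _∪_; _∩_)
open import Data.Fin.Subset.Properties using (drop-∷-⊆; p∪∁p≡⊤; _⊆?_)
import Data.Integer as ℤ
import Data.Integer.Properties as ℤ
open import Data.List using (List; []; _∷_; _++_; map; _∷ʳ_; concatMap)
open import Data.List.Membership.Propositional using (_∈_)
open import Data.List.Membership.Propositional.Properties using (∈-map⁺; ∈-++⁺ˡ; ∈-++⁺ʳ)
open import Data.List.Properties using (map-++; map-∘; unfold-reverse; reverse-map; ++-identityʳ)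
open import Data.List.Relation.Unary.All as All using (lookupAny)
open import Data.List.Relation.Unary.All.Properties using (all⁺)
open import Data.List.Relation.Unary.Any as Any using (Any; here; there)
open import Data.List.Relation.Unary.Any.Properties using (any⁻; ++⁺ˡ; ++⁺ʳ)
open import Data.Maybe using (Maybe; just; nothing)
import Data.Maybe.Properties as Maybe
open import Data.Nat
  using (ℕ; zero; suc; _+_; _*_; _∸_; _^_; _≤_; _<_; _≤ᵇ_; _<ᵇ_; _≡ᵇ_; z≤n; s≤s; _≤′_; ≤′-refl; ≤′-step)
import Data.Nat.Properties as ℕ
open import Data.Nat.ListAction using (sum)
open import Data.Nat.ListAction.Properties using (sum-++)
open import Data.Product using (_×_; _,_; proj₁; proj₂; Σ-syntax)
open import Data.Rational using (ℚ; 0ℚ) renaming (_≤_ to _≤ℚ_; _<_ to _<ℚ_; _+_ to _+ℚ_)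
open import Data.Rational.Base using (*≤*; *<*)
open import Data.Rational.Literals using (fromℤ)
import Data.Rational.Properties as ℚ
import Data.Rational.Unnormalised.Base as ℚᵘ
import Data.Rational.Unnormalised.Properties as ℚᵘ
open import Data.Sum using (_⊎_; inj₁; inj₂; [_,_]′)
open import Data.Unit using (tt)
open import Data.Vec using (Vec; []; _∷_; lookup; tabulate)
import Data.Vec.Properties as Vec
open import Data.Vec.Relation.Unary.Linked using (Linked; linked?)
open import Data.Vec.Relation.Unary.Linked.Properties using (lookup⁺)
open import Function using (_∘_; id)
open import Function.Bundles using (_⇔_; mk⇔; Equivalence)
open import Relation.Binary.PropositionalEquality
  using (_≡_; refl; sym; trans; cong; cong₂; subst; subst₂; module ≡-Reasoning)
open import Relation.Nullary using (¬_; contradiction)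
open import Relation.Nullary.Decidable using (Dec; yes; no; isYes; toWitness; fromWitness; _×-dec_)

module ℕ-Comm = CommSemigroupProperties ℕ.+-commutativeSemigroup
module ℚ-Comm = CommSemigroupProperties
  (CommutativeMonoid.commutativeSemigroup ℚ.+-0-commutativeMonoid)

-- Sums over coalitions and the rank

sumSubsets : (n : ℕ) → (Subset n → ℕ) → ℕ
sumSubsets zero    f = f []
sumSubsets (suc n) f = sumSubsets n (f ∘ (true ∷_)) + sumSubsets n (f ∘ (false ∷_))

sum-map-allSubsets : ∀ n (f : Subset n → ℕ) → sum (map f (allSubsets n)) ≡ sumSubsets n f
sum-map-allSubsets zero    f = ℕ.+-identityʳ (f [])
sum-map-allSubsets (suc n) f = begin
  sum (map f (map (true ∷_) ss ++ map (false ∷_) ss))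
    ≡⟨ cong sum (map-++ f (map (true ∷_) ss) (map (false ∷_) ss)) ⟩
  sum (map f (map (true ∷_) ss) ++ map f (map (false ∷_) ss))
    ≡⟨ sum-++ (map f (map (true ∷_) ss)) _ ⟩
  sum (map f (map (true ∷_) ss)) + sum (map f (map (false ∷_) ss))
    ≡⟨ cong₂ _+_ (half true) (half false) ⟩
  sumSubsets (suc n) f ∎
  where
  open ≡-Reasoning
  ss : List (Subset n)
  ss = allSubsets n
  half : ∀ b → sum (map f (map (b ∷_) ss)) ≡ sumSubsets n (f ∘ (b ∷_))
  half b = trans (cong sum (sym (map-∘ ss))) (sum-map-allSubsets n (f ∘ (b ∷_)))

sumSubsets-cong : ∀ n {f g : Subset n → ℕ} → (∀ S → f S ≡ g S) → sumSubsets n f ≡ sumSubsets n g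
sumSubsets-cong zero    f≗g = f≗g []
sumSubsets-cong (suc n) f≗g =
  cong₂ _+_ (sumSubsets-cong n (f≗g ∘ (true ∷_))) (sumSubsets-cong n (f≗g ∘ (false ∷_)))

sumSubsets-+ : ∀ n (f g : Subset n → ℕ) →
               sumSubsets n (λ S → f S + g S) ≡ sumSubsets n f + sumSubsets n g
sumSubsets-+ zero    f g = refl
sumSubsets-+ (suc n) f g = trans
  (cong₂ _+_ (sumSubsets-+ n (f ∘ (true ∷_)) (g ∘ (true ∷_)))
             (sumSubsets-+ n (f ∘ (false ∷_)) (g ∘ (false ∷_))))
  (ℕ-Comm.interchange (sumSubsets n (f ∘ (true ∷_))) _ _ _)

sumSubsets-mono : ∀ n {f g : Subset n → ℕ} → (∀ S → f S ≤ g S) → sumSubsets n f ≤ sumSubsets n g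
sumSubsets-mono zero    f≤g = f≤g []
sumSubsets-mono (suc n) f≤g =
  ℕ.+-mono-≤ (sumSubsets-mono n (f≤g ∘ (true ∷_))) (sumSubsets-mono n (f≤g ∘ (false ∷_)))

sumSubsets-mono-< : ∀ n {f g : Subset n → ℕ} → (∀ S → f S ≤ g S) →
                    (A : Subset n) → f A < g A → sumSubsets n f < sumSubsets n g
sumSubsets-mono-< zero    f≤g []      fA<gA = fA<gA
sumSubsets-mono-< (suc n) f≤g (true ∷ A) fA<gA =
  ℕ.+-mono-<-≤ (sumSubsets-mono-< n (f≤g ∘ (true ∷_)) A fA<gA) (sumSubsets-mono n (f≤g ∘ (false ∷_)))
sumSubsets-mono-< (suc n) f≤g (false ∷ A) fA<gA =
  ℕ.+-mono-≤-< (sumSubsets-mono n (f≤g ∘ (true ∷_))) (sumSubsets-mono-< n (f≤g ∘ (false ∷_)) A fA<gA)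

sumSubsets-∁ : ∀ n (f : Subset n → ℕ) → sumSubsets n (f ∘ ∁) ≡ sumSubsets n f
sumSubsets-∁ zero    f = refl
sumSubsets-∁ (suc n) f = trans
  (cong₂ _+_ (sumSubsets-∁ n (f ∘ (false ∷_))) (sumSubsets-∁ n (f ∘ (true ∷_))))
  (ℕ.+-comm (sumSubsets n (f ∘ (false ∷_))) _)

sumSubsets-1 : ∀ n → sumSubsets n (λ _ → 1) ≡ 2 ^ n
sumSubsets-1 zero    = refl
sumSubsets-1 (suc n) = trans (cong₂ _+_ (sumSubsets-1 n) (sumSubsets-1 n))
                             (cong (2 ^ n +_) (sym (ℕ.+-identityʳ (2 ^ n))))

loses : ∀ {n} → Game n → Subset n → ℕ
loses v S = if v S then 0 else 1

rank≡sumSubsets : ∀ {n} (v : Game n) → rank v ≡ sumSubsets n (loses v)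
rank≡sumSubsets {n} v = sum-map-allSubsets n (loses v)

rank-cong : ∀ {n} {v u : Game n} → (∀ S → v S ≡ u S) → rank v ≡ rank u
rank-cong {n} {v} {u} v≗u = begin
  rank v                  ≡⟨ rank≡sumSubsets v ⟩
  sumSubsets n (loses v)  ≡⟨ sumSubsets-cong n (cong (λ b → if b then 0 else 1) ∘ v≗u) ⟩
  sumSubsets n (loses u)  ≡⟨ rank≡sumSubsets u ⟨
  rank u                  ∎
  where open ≡-Reasoning

sumSubsets-complementPairs : ∀ {n} (v : Game n) →
  sumSubsets n (λ S → loses v S + loses v (∁ S)) ≡ rank v + rank v
sumSubsets-complementPairs {n} v = begin
  sumSubsets n (λ S → loses v S + loses v (∁ S))
    ≡⟨ sumSubsets-+ n (loses v) (loses v ∘ ∁) ⟩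
  sumSubsets n (loses v) + sumSubsets n (loses v ∘ ∁)
    ≡⟨ cong (sumSubsets n (loses v) +_) (sumSubsets-∁ n (loses v)) ⟩
  sumSubsets n (loses v) + sumSubsets n (loses v)
    ≡⟨ cong₂ _+_ (rank≡sumSubsets v) (rank≡sumSubsets v) ⟨
  rank v + rank v
    ∎
  where open ≡-Reasoning

proper⇒complementPair-loses : ∀ {n} (v : Game n) → IsProper v → ∀ S → 1 ≤ loses v S + loses v (∁ S)
proper⇒complementPair-loses v proper S with v S in vS | v (∁ S) in v∁S
... | true  | true  = contradiction (vS , v∁S) (proper S)
... | true  | false = ℕ.≤-refl
... | false | _     = s≤s z≤n

proper⇒half≤rank : ∀ {m} (v : Game (suc m)) → IsProper v → 2 ^ m ≤ rank v
proper⇒half≤rank {m} v proper = ℕ.*-cancelˡ-≤ 2 (begin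
  2 ^ suc m                                              ≡⟨ sumSubsets-1 (suc m) ⟨
  sumSubsets (suc m) (λ _ → 1)                           ≤⟨ sumSubsets-mono (suc m) pairs≥1 ⟩
  sumSubsets (suc m) (λ S → loses v S + loses v (∁ S))   ≡⟨ sumSubsets-complementPairs v ⟩
  rank v + rank v                                        ≡⟨ cong (rank v +_) (ℕ.+-identityʳ (rank v)) ⟨
  2 * rank v                                             ∎)
  where
  open ℕ.≤-Reasoning
  pairs≥1 : ∀ S → 1 ≤ loses v S + loses v (∁ S)
  pairs≥1 = proper⇒complementPair-loses v proper

rank<half : ∀ {m} (v : Game (suc m)) → (∀ S → loses v S + loses v (∁ S) ≤ 1) →
            ∀ A → Win v A → Win v (∁ A) → rank v < 2 ^ m
rank<half {m} v pairs≤1 A vA v∁A = ℕ.*-cancelˡ-< 2 (rank v) (2 ^ m) (begin-strict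
  2 * rank v                                             ≡⟨ cong (rank v +_) (ℕ.+-identityʳ (rank v)) ⟩
  rank v + rank v                                        ≡⟨ sumSubsets-complementPairs v ⟨
  sumSubsets (suc m) (λ S → loses v S + loses v (∁ S))   <⟨ sumSubsets-mono-< (suc m) pairs≤1 A A-pair-wins ⟩
  sumSubsets (suc m) (λ _ → 1)                           ≡⟨ sumSubsets-1 (suc m) ⟩
  2 ^ suc m                                              ∎)
  where
  open ℕ.≤-Reasoning
  A-pair-wins : loses v A + loses v (∁ A) < 1
  A-pair-wins rewrite vA | v∁A = s≤s z≤n

-- Properness versus weightedness

weightOf-∪-∩ : ∀ {n} (w : Fin n → ℚ) (A B : Subset n) →
               weightOf w A +ℚ weightOf w B ≡ weightOf w (A ∪ B) +ℚ weightOf w (A ∩ B)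
weightOf-∪-∩ w []      []      = refl
weightOf-∪-∩ w (a ∷ A) (b ∷ B) = begin
  (x a +ℚ wA) +ℚ (x b +ℚ wB)                   ≡⟨ ℚ-Comm.interchange (x a) wA (x b) wB ⟩
  (x a +ℚ x b) +ℚ (wA +ℚ wB)                   ≡⟨ cong₂ _+ℚ_ (voter a b) (weightOf-∪-∩ (w ∘ suc) A B) ⟩
  (x (a ∨ b) +ℚ x (a ∧ b)) +ℚ (wA∪B +ℚ wA∩B)   ≡⟨ ℚ-Comm.interchange (x (a ∨ b)) (x (a ∧ b)) wA∪B wA∩B ⟩
  (x (a ∨ b) +ℚ wA∪B) +ℚ (x (a ∧ b) +ℚ wA∩B)   ∎
  where
  open ≡-Reasoning
  x : Bool → ℚ
  x c = if c then w zero else 0ℚ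
  wA wB wA∪B wA∩B : ℚ
  wA = weightOf (w ∘ suc) A
  wB = weightOf (w ∘ suc) B
  wA∪B = weightOf (w ∘ suc) (A ∪ B)
  wA∩B = weightOf (w ∘ suc) (A ∩ B)
  voter : ∀ a b → x a +ℚ x b ≡ x (a ∨ b) +ℚ x (a ∧ b)
  voter true  true  = refl
  voter true  false = refl
  voter false true  = ℚ.+-comm 0ℚ (w zero)
  voter false false = refl

weighted⇒separated : ∀ {n} {v : Game n} → IsWeighted v →
  Σ[ w ∈ (Fin n → ℚ) ] Σ[ q ∈ ℚ ]
    ((∀ A → Win v A → q ≤ℚ weightOf w A) × (∀ B → v B ≡ false → weightOf w B <ℚ q))
weighted⇒separated {v = v} (_ , w , q , _ , _ , _ , _ , winning⇔) =
  w , q , Equivalence.to ∘ winning⇔ , losing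
  where
  losing : ∀ B → v B ≡ false → weightOf w B <ℚ q
  losing B vB = ℚ.≰⇒> λ q≤wB → contradiction (trans (sym (Equivalence.from (winning⇔ B) q≤wB)) vB) λ ()

-- The ∪/∩ equations say that both pairs consist of the same multiset of voters (a trade).
trade⇒¬weighted : ∀ {n} {v : Game n} {A₁ A₂ B₁ B₂ : Subset n} →
  A₁ ∪ A₂ ≡ B₁ ∪ B₂ → A₁ ∩ A₂ ≡ B₁ ∩ B₂ →
  Win v A₁ → Win v A₂ → v B₁ ≡ false → v B₂ ≡ false → ¬ IsWeighted v
trade⇒¬weighted {A₁ = A₁} {A₂} {B₁} {B₂} ∪≡ ∩≡ vA₁ vA₂ vB₁ vB₂ weighted
  with weighted⇒separated weighted
... | w , q , win⇒q≤ , lose⇒<q = ℚ.<-irrefl refl (begin-strict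
  q +ℚ q                                   ≤⟨ ℚ.+-mono-≤ (win⇒q≤ A₁ vA₁) (win⇒q≤ A₂ vA₂) ⟩
  weightOf w A₁ +ℚ weightOf w A₂           ≡⟨ weightOf-∪-∩ w A₁ A₂ ⟩
  weightOf w (A₁ ∪ A₂) +ℚ weightOf w (A₁ ∩ A₂) ≡⟨ cong₂ (λ X Y → weightOf w X +ℚ weightOf w Y) ∪≡ ∩≡ ⟩
  weightOf w (B₁ ∪ B₂) +ℚ weightOf w (B₁ ∩ B₂) ≡⟨ weightOf-∪-∩ w B₁ B₂ ⟨
  weightOf w B₁ +ℚ weightOf w B₂           <⟨ ℚ.+-mono-< (lose⇒<q B₁ vB₁) (lose⇒<q B₂ vB₂) ⟩
  q +ℚ q                                   ∎)
  where open ℚ.≤-Reasoning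

p∩∁p≡⊥ : ∀ {n} (p : Subset n) → p ∩ ∁ p ≡ ⊥
p∩∁p≡⊥ []          = refl
p∩∁p≡⊥ (true ∷ p)  = cong (false ∷_) (p∩∁p≡⊥ p)
p∩∁p≡⊥ (false ∷ p) = cong (false ∷_) (p∩∁p≡⊥ p)

weighted-improper⇒complementPair-wins : ∀ {n} (v : Game n) → IsWeighted v →
  ∀ A → Win v A → Win v (∁ A) → ∀ S → loses v S + loses v (∁ S) ≤ 1
weighted-improper⇒complementPair-wins v weighted A vA v∁A S with v S in vS | v (∁ S) in v∁S
... | true  | true  = z≤n
... | true  | false = ℕ.≤-refl
... | false | true  = ℕ.≤-refl
... | false | false = ⊥-elim (trade⇒¬weighted
      (trans (p∪∁p≡⊤ A) (sym (p∪∁p≡⊤ S))) (trans (p∩∁p≡⊥ A) (sym (p∩∁p≡⊥ S))) vA v∁A vS v∁S weighted)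

weighted∧half≤rank⇒proper : ∀ {m} (v : Game (suc m)) → IsWeighted v → 2 ^ m ≤ rank v → IsProper v
weighted∧half≤rank⇒proper v weighted half≤rank A (vA , v∁A) =
  ℕ.<⇒≱ (rank<half v (weighted-improper⇒complementPair-wins v weighted A vA v∁A) A vA v∁A) half≤rank

noSimpleGame₀ : (v : Game 0) → ¬ IsSimple v
noSimpleGame₀ v (v⊤ , v⊥≢true , _) = v⊥≢true v⊤

Wplus⊆Pi : ∀ n (v : Game n) → InWplus n v → InPi n v
Wplus⊆Pi zero    v ((linear , _) , _)    = contradiction (proj₁ linear) (noSimpleGame₀ v)
Wplus⊆Pi (suc m) v (weighted , half≤rank) =
  proj₁ weighted , weighted∧half≤rank⇒proper v weighted half≤rank

Pi⊆Jplus : ∀ n (v : Game n) → InPi n v → InJplus n v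
Pi⊆Jplus zero    v (linear , _)      = contradiction (proj₁ linear) (noSimpleGame₀ v)
Pi⊆Jplus (suc m) v (linear , proper) = linear , proper⇒half≤rank v proper

-- A dummy voter

addDummy : ∀ {n} → Game n → Game (suc n)
addDummy v (_ ∷ S) = v S

dummyVoter : Bool → List ℕ
dummyVoter b = if b then 0 ∷ [] else []

desc-∷ : ∀ {n} b (A : Subset n) → desc (b ∷ A) ≡ map suc (desc A) ++ dummyVoter b
desc-∷ true  A = trans (unfold-reverse 0 (map suc (members A)))
                       (cong (_∷ʳ 0) (sym (reverse-map suc (members A))))
desc-∷ false A = trans (sym (reverse-map suc (members A))) (sym (++-identityʳ _))

Dom-drop-dummy : ∀ as bs xs c → Dom (map suc as ++ xs) (map suc bs ++ dummyVoter c) → Dom as bs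
Dom-drop-dummy []       bs       xs c     _                = tt
Dom-drop-dummy (a ∷ as) []       xs true  (() , _)
Dom-drop-dummy (a ∷ as) []       xs false ()
Dom-drop-dummy (a ∷ as) (b ∷ bs) xs c     (s≤s a≤b , rest) = a≤b , Dom-drop-dummy as bs xs c rest

addDummy-linear : ∀ {n} (v : Game n) → IsLinear v → IsLinear (addDummy v)
addDummy-linear v ((v⊤ , v⊥ , monotone) , shift-monotone) = (v⊤ , v⊥ , monotone′) , shift-monotone′
  where
  monotone′ : ∀ S R → S ⊆ R → Win (addDummy v) S → Win (addDummy v) R
  monotone′ (_ ∷ S) (_ ∷ R) S⊆R = monotone S R (drop-∷-⊆ S⊆R)
  shift-monotone′ : ∀ A B → B ≥M A → Win (addDummy v) A → Win (addDummy v) B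
  shift-monotone′ (a ∷ A) (b ∷ B) B≥A = shift-monotone A B
    (Dom-drop-dummy (desc A) (desc B) (dummyVoter a) b (subst₂ Dom (desc-∷ a A) (desc-∷ b B) B≥A))

addDummy-proper⇔ : ∀ {n} (v : Game n) → IsProper (addDummy v) ⇔ IsProper v
addDummy-proper⇔ v = mk⇔ (λ proper A → proper (true ∷ A)) (λ proper → λ { (_ ∷ A) → proper A })

rank-addDummy : ∀ {n} (v : Game n) → rank (addDummy v) ≡ rank v + rank v
rank-addDummy v = trans (rank≡sumSubsets (addDummy v))
                        (sym (cong₂ _+_ (rank≡sumSubsets v) (rank≡sumSubsets v)))

addDummy-weighted⇒weighted : ∀ {n} (v : Game n) → IsLinear v → IsWeighted (addDummy v) → IsWeighted v
addDummy-weighted⇒weighted v linear (_ , w , q , w₀≥0 , w-mono , q>0 , _ , winning⇔) =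
  linear , w ∘ suc , q , w′₀≥0 , (λ i j i≤j → w-mono (suc i) (suc j) (s≤s i≤j)) , q>0 ,
  Equivalence.to (winning⇔′ ⊤) (proj₁ (proj₁ linear)) , winning⇔′
  where
  w′₀≥0 : ∀ i → toℕ i ≡ 0 → 0ℚ ≤ℚ w (suc i)
  w′₀≥0 i _ = ℚ.≤-trans (w₀≥0 zero refl) (w-mono zero (suc i) z≤n)
  winning⇔′ : ∀ A → Win v A ⇔ (q ≤ℚ weightOf (w ∘ suc) A)
  winning⇔′ A = mk⇔ (subst (q ≤ℚ_) (ℚ.+-identityˡ _) ∘ Equivalence.to (winning⇔ (false ∷ A)))
                    (Equivalence.from (winning⇔ (false ∷ A)) ∘ subst (q ≤ℚ_) (sym (ℚ.+-identityˡ _)))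

2^n≤2^[n∸1]+2^[n∸1] : ∀ n → 2 ^ n ≤ 2 ^ (n ∸ 1) + 2 ^ (n ∸ 1)
2^n≤2^[n∸1]+2^[n∸1] zero    = s≤s z≤n
2^n≤2^[n∸1]+2^[n∸1] (suc m) = ℕ.≤-reflexive (cong (2 ^ m +_) (ℕ.+-identityʳ (2 ^ m)))

Pi∖Wplus-ascends : ∀ {n} → StrictlyLarger n (InWplus n) (InPi n) →
                   StrictlyLarger (suc n) (InWplus (suc n)) (InPi (suc n))
Pi∖Wplus-ascends {n} (v , (linear , proper) , ¬Wplus) =
  addDummy v ,
  (addDummy-linear v linear , Equivalence.from (addDummy-proper⇔ v) proper) ,
  λ (weighted , _) → ¬Wplus (addDummy-weighted⇒weighted v linear weighted ,
                             proj₂ (Pi⊆Jplus n v (linear , proper)))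

Jplus∖Pi-ascends : ∀ {n} → StrictlyLarger n (InPi n) (InJplus n) →
                   StrictlyLarger (suc n) (InPi (suc n)) (InJplus (suc n))
Jplus∖Pi-ascends {n} (v , (linear , half≤rank) , ¬Pi) =
  addDummy v ,
  (addDummy-linear v linear , ℕ.≤-trans (2^n≤2^[n∸1]+2^[n∸1] n)
    (subst (_ ≤_) (sym (rank-addDummy v)) (ℕ.+-mono-≤ half≤rank half≤rank))) ,
  λ (_ , proper) → ¬Pi (linear , Equivalence.to (addDummy-proper⇔ v) proper)

ascend : ∀ {P : ℕ → Set} {m} → P m → (∀ {n} → P n → P (suc n)) → ∀ {n} → m ≤ n → P n
ascend {P} {m} base step m≤n = go (ℕ.≤⇒≤′ m≤n)
  where
  go : ∀ {n} → m ≤′ n → P n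
  go ≤′-refl        = base
  go (≤′-step m≤′n) = step (go m≤′n)

toℚ : ℕ → ℚ
toℚ k = fromℤ (ℤ.+ k)

+k*1≡+k : ∀ k → ℤ.+ k ℤ.* ℤ.+ 1 ≡ ℤ.+ k
+k*1≡+k k = ℤ.*-identityʳ (ℤ.+ k)

toℚ-mono-≤ : ∀ {a b} → a ≤ b → toℚ a ≤ℚ toℚ b
toℚ-mono-≤ {a} {b} a≤b = *≤* (subst₂ ℤ._≤_ (sym (+k*1≡+k a)) (sym (+k*1≡+k b)) (ℤ.+≤+ a≤b))

toℚ-cancel-≤ : ∀ {a b} → toℚ a ≤ℚ toℚ b → a ≤ b
toℚ-cancel-≤ {a} {b} (*≤* a≤b) = ℤ.drop‿+≤+ (subst₂ ℤ._≤_ (+k*1≡+k a) (+k*1≡+k b) a≤b)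

toℚ-mono-< : ∀ {a b} → a < b → toℚ a <ℚ toℚ b
toℚ-mono-< {a} {b} a<b = *<* (subst₂ ℤ._<_ (sym (+k*1≡+k a)) (sym (+k*1≡+k b)) (ℤ.+<+ a<b))

toℚ-homo-+ : ∀ a b → toℚ a +ℚ toℚ b ≡ toℚ (a + b)
toℚ-homo-+ a b = ℚ.toℚᵘ-injective (ℚᵘ.≃-trans (ℚ.toℚᵘ-homo-+ (toℚ a) (toℚ b)) (ℚᵘ.*≡* cross))
  where
  cross : (ℤ.+ a ℤ.* ℤ.+ 1 ℤ.+ ℤ.+ b ℤ.* ℤ.+ 1) ℤ.* ℤ.+ 1 ≡ ℤ.+ (a + b) ℤ.* ℤ.+ 1
  cross = trans (ℤ.*-identityʳ _) (trans (cong₂ ℤ._+_ (+k*1≡+k a) (+k*1≡+k b)) (sym (+k*1≡+k (a + b))))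

natWeight : ∀ {n} → Vec ℕ n → Subset n → ℕ
natWeight []      []      = 0
natWeight (x ∷ w) (b ∷ S) = (if b then x else 0) + natWeight w S

weightOf-toℚ : ∀ {n} (w : Vec ℕ n) (S : Subset n) → weightOf (toℚ ∘ lookup w) S ≡ toℚ (natWeight w S)
weightOf-toℚ []      []      = refl
weightOf-toℚ (x ∷ w) (b ∷ S) =
  trans (cong₂ _+ℚ_ (voter b) (weightOf-toℚ w S)) (toℚ-homo-+ _ (natWeight w S))
  where
  voter : ∀ b → (if b then toℚ x else 0ℚ) ≡ toℚ (if b then x else 0)
  voter true  = refl
  voter false = refl

Linked-lookup-mono : ∀ {n} {w : Vec ℕ n} → Linked _≤_ w → ∀ i j → toℕ i ≤ toℕ j → lookup w i ≤ lookup w j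
Linked-lookup-mono linked i j i≤j with i Fin.≟ j
... | yes refl = ℕ.≤-refl
... | no  i≢j  = lookup⁺ ℕ.≤-trans linked (Fin.≤∧≢⇒< i≤j i≢j)

natWeighted⇒weighted : ∀ {n} (v : Game n) → IsLinear v → (w : Vec ℕ n) (q : ℕ) →
  Linked _≤_ w → 0 < q → q ≤ natWeight w ⊤ → (∀ A → v A ≡ (q ≤ᵇ natWeight w A)) → IsWeighted v
natWeighted⇒weighted v linear w q ascending q>0 q≤total v≡ =
  linear , toℚ ∘ lookup w , toℚ q , (λ _ _ → toℚ-mono-≤ z≤n) ,
  (λ i j i≤j → toℚ-mono-≤ (Linked-lookup-mono ascending i j i≤j)) , toℚ-mono-< q>0 ,
  quota≤ q≤total , λ A → mk⇔ (win⇒quota≤ A) (quota≤⇒win A)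
  where
  quota≤ : ∀ {A} → q ≤ natWeight w A → toℚ q ≤ℚ weightOf (toℚ ∘ lookup w) A
  quota≤ {A} q≤wA = subst (toℚ q ≤ℚ_) (sym (weightOf-toℚ w A)) (toℚ-mono-≤ q≤wA)
  win⇒quota≤ : ∀ A → Win v A → toℚ q ≤ℚ weightOf (toℚ ∘ lookup w) A
  win⇒quota≤ A vA = quota≤ (ℕ.≤ᵇ⇒≤ q _ (Equivalence.from T-≡ (trans (sym (v≡ A)) vA)))
  quota≤⇒win : ∀ A → toℚ q ≤ℚ weightOf (toℚ ∘ lookup w) A → Win v A
  quota≤⇒win A q≤wA = trans (v≡ A) (Equivalence.to T-≡ (ℕ.≤⇒≤ᵇ (toℚ-cancel-≤
    (subst (toℚ q ≤ℚ_) (weightOf-toℚ w A) q≤wA))))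

∈-allSubsets : ∀ {n} (S : Subset n) → S ∈ allSubsets n
∈-allSubsets []          = here refl
∈-allSubsets (true ∷ S)  = ∈-++⁺ˡ (∈-map⁺ (true ∷_) (∈-allSubsets S))
∈-allSubsets (false ∷ S) = ∈-++⁺ʳ (map (true ∷_) (allSubsets _)) (∈-map⁺ (false ∷_) (∈-allSubsets S))

T-all-allSubsets : ∀ {n} (p : Subset n → Bool) → T (all p (allSubsets n)) → ∀ S → T (p S)
T-all-allSubsets p all-p S = All.lookup (all⁺ p _ all-p) (∈-allSubsets S)

_≥M?_ : ∀ {n} (B A : Subset n) → Dec (B ≥M A)
B ≥M? A = dominates? (desc A) (desc B)
  where
  dominates? : ∀ as bs → Dec (Dom as bs)
  dominates? []       bs       = yes tt
  dominates? (a ∷ as) []       = no λ ()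
  dominates? (a ∷ as) (b ∷ bs) = a ℕ.≤? b ×-dec dominates? as bs

_⇒ᵇ_ : Bool → Bool → Bool
a ⇒ᵇ b = not a ∨ b

T-⇒ᵇ : ∀ {a b} → T (a ⇒ᵇ b) → T a → T b
T-⇒ᵇ {true} b a = b

checkUpwardClosed : ∀ {n} → Game n → Bool
checkUpwardClosed {n} v = all (λ A → v A ⇒ᵇ
  all (λ B → v B ∨ not (isYes (A ⊆? B) ∨ isYes (B ≥M? A))) (allSubsets n)) (allSubsets n)

checkLinear : ∀ {n} → Game n → Bool
checkLinear v = v ⊤ ∧ (not (v ⊥) ∧ checkUpwardClosed v)

checkLinear-sound : ∀ {n} (v : Game n) → T (checkLinear v) → IsLinear v
checkLinear-sound v checked with Equivalence.to (T-∧ {v ⊤}) checked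
... | v⊤ , rest with Equivalence.to (T-∧ {not (v ⊥)}) rest
... | v⊥-loses , upwardClosed = (Equivalence.to T-≡ v⊤ , v⊥≢true , monotone) , shift-monotone
  where
  v⊥≢true : ¬ Win v ⊥
  v⊥≢true v⊥ = subst (T ∘ not) v⊥ v⊥-loses
  upward : ∀ A B → T (isYes (A ⊆? B) ∨ isYes (B ≥M? A)) → Win v A → Win v B
  upward A B above vA
    with Equivalence.to (T-∨ {v B})
      (T-all-allSubsets _ (T-⇒ᵇ (T-all-allSubsets _ upwardClosed A) (Equivalence.from T-≡ vA)) B)
  ... | inj₁ vB    = Equivalence.to T-≡ vB
  ... | inj₂ below = contradiction above λ c → subst (T ∘ not) (Equivalence.to T-≡ c) below
  monotone : ∀ S R → S ⊆ R → Win v S → Win v R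
  monotone S R S⊆R =
    upward S R (Equivalence.from (T-∨ {isYes (S ⊆? R)}) (inj₁ (fromWitness {a? = S ⊆? R} S⊆R)))
  shift-monotone : ∀ A B → B ≥M A → Win v A → Win v B
  shift-monotone A B B≥A =
    upward A B (Equivalence.from (T-∨ {isYes (A ⊆? B)}) (inj₂ (fromWitness {a? = B ≥M? A} B≥A)))

checkProper : ∀ {n} → Game n → Bool
checkProper {n} v = all (λ A → not (v A ∧ v (∁ A))) (allSubsets n)

checkProper-sound : ∀ {n} (v : Game n) → T (checkProper v) → IsProper v
checkProper-sound v checked A (vA , v∁A) =
  subst T (cong₂ (λ a b → not (a ∧ b)) vA v∁A) (T-all-allSubsets _ checked A)

-- Exhaustive enumeration of linear games

data PartialGame : ℕ → Set where
  leaf : Maybe Bool → PartialGame zero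
  node : ∀ {n} → PartialGame n → PartialGame n → PartialGame (suc n)

undecided : ∀ n → PartialGame n
undecided zero    = leaf nothing
undecided (suc n) = node (undecided n) (undecided n)

_‼_ : ∀ {n} → PartialGame n → Subset n → Maybe Bool
leaf m   ‼ []        = m
node t f ‼ (true ∷ S)  = t ‼ S
node t f ‼ (false ∷ S) = f ‼ S

_[_]≔_ : ∀ {n} → PartialGame n → Subset n → Bool → PartialGame n
leaf _   [ [] ]≔ b        = leaf (just b)
node t f [ true ∷ S ]≔ b  = node (t [ S ]≔ b) f
node t f [ false ∷ S ]≔ b = node t (f [ S ]≔ b)

Extends : ∀ {n} → Game n → PartialGame n → Set
Extends {n} v ρ = ∀ (S : Subset n) b → ρ ‼ S ≡ just b → v S ≡ b

extends-undecided : ∀ {n} (v : Game n) → Extends v (undecided n)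
extends-undecided {zero}  v []          _ ()
extends-undecided {suc n} v (true ∷ S)  = extends-undecided (v ∘ (true ∷_)) S
extends-undecided {suc n} v (false ∷ S) = extends-undecided (v ∘ (false ∷_)) S

extends-≔ : ∀ {n} {v : Game n} {ρ S b} → Extends v ρ → v S ≡ b → Extends v (ρ [ S ]≔ b)
extends-≔ {ρ = leaf _}   {[]}        extends vS []          _ refl = vS
extends-≔ {ρ = node t f} {true ∷ S}  extends vS (true ∷ R)  = extends-≔ {ρ = t} (extends ∘ (true ∷_)) vS R
extends-≔ {ρ = node t f} {true ∷ S}  extends vS (false ∷ R) = extends (false ∷ R)
extends-≔ {ρ = node t f} {false ∷ S} extends vS (true ∷ R)  = extends (true ∷ R)
extends-≔ {ρ = node t f} {false ∷ S} extends vS (false ∷ R) = extends-≔ {ρ = f} (extends ∘ (false ∷_)) vS R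

toGame : ∀ {n} → PartialGame n → Game n
toGame (leaf (just b)) []          = b
toGame (leaf nothing)  []          = false
toGame (node t f)      (true ∷ S)  = toGame t S
toGame (node t f)      (false ∷ S) = toGame f S

determines : ∀ {n} → PartialGame n → Game n → Bool
determines (leaf (just b)) u = isYes (b ≟ᵇ u [])
determines (leaf nothing)  u = false
determines (node t f)      u = determines t (u ∘ (true ∷_)) ∧ determines f (u ∘ (false ∷_))

determines-sound : ∀ {n} {v : Game n} ρ u → T (determines ρ u) → Extends v ρ → ∀ S → v S ≡ u S
determines-sound (leaf (just b)) u b≡u extends [] = trans (extends [] b refl) (toWitness b≡u)
determines-sound (node t f) u determined extends (true ∷ S) =
  determines-sound t _ (proj₁ (Equivalence.to (T-∧ {determines t _}) determined)) (extends ∘ (true ∷_)) S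
determines-sound (node t f) u determined extends (false ∷ S) =
  determines-sound f _ (proj₂ (Equivalence.to (T-∧ {determines t _}) determined)) (extends ∘ (false ∷_)) S

ProperIf : ∀ {n} → Bool → Game n → Set
ProperIf true  v = IsProper v
ProperIf false v = Data.Unit.⊤

upperCovers : ∀ {n} → Subset n → List (Subset n)
upperCovers []                = []
upperCovers (false ∷ S)       = (true ∷ S) ∷ map (false ∷_) (upperCovers S)
upperCovers (true ∷ [])       = []
upperCovers (true ∷ true ∷ S)  = map (true ∷_) (upperCovers (true ∷ S))
upperCovers (true ∷ false ∷ S) = (false ∷ true ∷ S) ∷ map (true ∷_) (upperCovers (false ∷ S))

_≟ˢ_ : ∀ {n} (S R : Subset n) → Dec (S ≡ R)
_≟ˢ_ = Vec.≡-dec _≟ᵇ_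

decidedAs : ∀ {n} → Bool → PartialGame n → Subset n → Bool
decidedAs b ρ S = isYes (Maybe.≡-dec _≟ᵇ_ (ρ ‼ S) (just b))

-- Only the checked dominance matters for soundness; `upperCovers` merely keeps the search small.
cannotWin : ∀ {n} → Bool → PartialGame n → Subset n → Bool
cannotWin onlyProper ρ S =
  any (λ C → decidedAs false ρ C ∧ isYes (C ≥M? S)) (upperCovers S) ∨
  (onlyProper ∧ decidedAs true ρ (∁ S) ∨ isYes (S ≟ˢ ⊥))

cannotWin-sound : ∀ {n} {v : Game n} onlyProper ρ S → T (cannotWin onlyProper ρ S) →
  IsLinear v → ProperIf onlyProper v → Extends v ρ → ¬ Win v S
cannotWin-sound onlyProper ρ S excluded (_ , shift-monotone) _ extends
  with Equivalence.to (T-∨ {any _ (upperCovers S)}) excluded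
... | inj₁ losingCover with Any.satisfied (any⁻ _ (upperCovers S) losingCover)
...   | C , C-loses∧C≥S with Equivalence.to (T-∧ {decidedAs false ρ C}) C-loses∧C≥S
...     | C-loses , C≥S = λ vS → contradiction
          (trans (sym (shift-monotone S C (toWitness C≥S) vS)) (extends C false (toWitness C-loses)))
          λ ()
cannotWin-sound {v = v} onlyProper ρ S _ ((_ , v⊥≢true , _) , _) proper extends | inj₂ rest =
  improperOrEmpty onlyProper proper rest
  where
  empty : T (isYes (S ≟ˢ ⊥)) → ¬ Win v S
  empty S≡⊥ vS = v⊥≢true (subst (Win v) (toWitness S≡⊥) vS)
  improperOrEmpty : ∀ b → ProperIf b v → T (b ∧ decidedAs true ρ (∁ S) ∨ isYes (S ≟ˢ ⊥)) → ¬ Win v S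
  improperOrEmpty true proper rest with Equivalence.to (T-∨ {decidedAs true ρ (∁ S)}) rest
  ... | inj₁ ∁S-wins = λ vS → proper S (vS , extends (∁ S) true (toWitness ∁S-wins))
  ... | inj₂ S≡⊥     = empty S≡⊥
  improperOrEmpty false _ S≡⊥ = empty S≡⊥

completions : ∀ {n} → Bool → List (Subset n) → PartialGame n → List (PartialGame n)
completions onlyProper []       ρ = ρ ∷ []
completions onlyProper (S ∷ Ss) ρ =
  (if isYes (S ≟ˢ ⊤) then [] else completions onlyProper Ss (ρ [ S ]≔ false)) ++
  (if cannotWin onlyProper ρ S then [] else completions onlyProper Ss (ρ [ S ]≔ true))

completions-complete : ∀ {n} {v : Game n} onlyProper Ss ρ → IsLinear v → ProperIf onlyProper v →
  Extends v ρ → Any (Extends v) (completions onlyProper Ss ρ)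
completions-complete onlyProper []       ρ _ _ extends = here extends
completions-complete {v = v} onlyProper (S ∷ Ss) ρ linear proper extends with v S in vS
... | false = ++⁺ˡ losing
  where
  losing : Any (Extends v) (if isYes (S ≟ˢ ⊤) then [] else completions onlyProper Ss (ρ [ S ]≔ false))
  losing with S ≟ˢ ⊤
  ... | yes refl = contradiction (trans (sym (proj₁ (proj₁ linear))) vS) λ ()
  ... | no _     = completions-complete onlyProper Ss _ linear proper (extends-≔ {ρ = ρ} extends vS)
... | true = ++⁺ʳ _ winning
  where
  winning : Any (Extends v)
    (if cannotWin onlyProper ρ S then [] else completions onlyProper Ss (ρ [ S ]≔ true))
  winning with cannotWin onlyProper ρ S in excluded
  ... | true  = contradiction vS
      (cannotWin-sound onlyProper ρ S (Equivalence.from T-≡ excluded) linear proper extends)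
  ... | false = completions-complete onlyProper Ss _ linear proper (extends-≔ {ρ = ρ} extends vS)

-- Binary order with voter n most significant: every upper cover of S in M(n) precedes S.
descendingSubsets : (n : ℕ) → List (Subset n)
descendingSubsets zero    = [] ∷ []
descendingSubsets (suc n) = concatMap (λ S → (true ∷ S) ∷ (false ∷ S) ∷ []) (descendingSubsets n)

linearGames : Bool → (n : ℕ) → List (PartialGame n)
linearGames onlyProper n = completions onlyProper (descendingSubsets n) (undecided n)

linearGames-complete : ∀ {n} {v : Game n} onlyProper → IsLinear v → ProperIf onlyProper v →
  Any (Extends v) (linearGames onlyProper n)
linearGames-complete {n} {v} onlyProper linear proper =
  completions-complete onlyProper (descendingSubsets n) (undecided n) linear proper (extends-undecided v)

-- Small numbers of voters

Certificate : ℕ → Set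
Certificate n = Vec ℕ n × ℕ

validCertificate? : ∀ {n} (w : Vec ℕ n) (q : ℕ) → Dec (Linked _≤_ w × 0 < q × q ≤ natWeight w ⊤)
validCertificate? w q = linked? ℕ._≤?_ w ×-dec 0 ℕ.<? q ×-dec q ℕ.≤? natWeight w ⊤

certifies : ∀ {n} → Certificate n → PartialGame n → Bool
certifies (w , q) ρ = isYes (validCertificate? w q) ∧ determines ρ (λ S → q ≤ᵇ natWeight w S)

certifies-sound : ∀ {n} {v : Game n} c ρ → T (certifies c ρ) → Extends v ρ → IsLinear v → IsWeighted v
certifies-sound {v = v} (w , q) ρ certified extends linear
  with Equivalence.to (T-∧ {isYes (validCertificate? w q)}) certified
... | valid , determined with toWitness valid
... | ascending , q>0 , q≤total =
  natWeighted⇒weighted v linear w q ascending q>0 q≤total (determines-sound ρ _ determined extends)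

allCertified : ∀ {n} → List (PartialGame n) → List (Certificate n) → Bool
allCertified []       _        = true
allCertified (_ ∷ _)  []       = false
allCertified (ρ ∷ ρs) (c ∷ cs) = certifies c ρ ∧ allCertified ρs cs

allCertified-sound : ∀ {n} {v : Game n} ρs cs → T (allCertified ρs cs) → Any (Extends v) ρs →
  IsLinear v → IsWeighted v
allCertified-sound (ρ ∷ ρs) (c ∷ cs) certified (here extends) =
  certifies-sound c ρ (proj₁ (Equivalence.to (T-∧ {certifies c ρ}) certified)) extends
allCertified-sound (ρ ∷ ρs) (c ∷ cs) certified (there found) =
  allCertified-sound ρs cs (proj₂ (Equivalence.to (T-∧ {certifies c ρ}) certified)) found

properLinear⇒weighted : ∀ n (cs : List (Certificate n)) → T (allCertified (linearGames true n) cs) →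
  ∀ v → InPi n v → IsWeighted v
properLinear⇒weighted n cs certified v (linear , proper) =
  allCertified-sound (linearGames true n) cs certified (linearGames-complete true linear proper) linear

rankBelowHalfOrProper : ∀ {n} → PartialGame n → Bool
rankBelowHalfOrProper {n} ρ =
  determines ρ (toGame ρ) ∧ ((rank (toGame ρ) <ᵇ 2 ^ (n ∸ 1)) ∨ checkProper (toGame ρ))

rankBelowHalfOrProper-sound : ∀ {n} {v : Game n} ρ → T (rankBelowHalfOrProper ρ) → Extends v ρ →
  rank v < 2 ^ (n ∸ 1) ⊎ IsProper v
rankBelowHalfOrProper-sound {n} {v} ρ checked extends
  with Equivalence.to (T-∧ {determines ρ (toGame ρ)}) checked
... | determined , rest with Equivalence.to (T-∨ {rank (toGame ρ) <ᵇ 2 ^ (n ∸ 1)}) rest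
... | inj₁ below  = inj₁ (subst (_< 2 ^ (n ∸ 1)) (sym (rank-cong v≗ρ)) (ℕ.<ᵇ⇒< _ _ below))
  where v≗ρ = determines-sound ρ (toGame ρ) determined extends
... | inj₂ proper = inj₂ λ A (vA , v∁A) → checkProper-sound (toGame ρ) proper A
  (trans (sym (v≗ρ A)) vA , trans (sym (v≗ρ (∁ A))) v∁A)
  where v≗ρ = determines-sound ρ (toGame ρ) determined extends

Jplus⇒proper-byEnumeration : ∀ n → T (all rankBelowHalfOrProper (linearGames false n)) →
  ∀ v → InJplus n v → IsProper v
Jplus⇒proper-byEnumeration n checked v (linear , half≤rank) =
  [ (λ below → contradiction half≤rank (ℕ.<⇒≱ below)) , id ]′
    (rankBelowHalfOrProper-sound (Any.lookup found) (proj₁ checked∧extends) (proj₂ checked∧extends))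
  where
  found : Any (Extends v) (linearGames false n)
  found = linearGames-complete false linear tt
  checked∧extends : T (rankBelowHalfOrProper (Any.lookup found)) × Extends v (Any.lookup found)
  checked∧extends = lookupAny (all⁺ _ (linearGames false n) checked) found

-- Weights of voters 1, …, n and quota for each game of `linearGames true n`, in that order.
weightCertificates : (n : ℕ) → List (Certificate n)
weightCertificates 1 = ((1 ∷ []) , 1) ∷ []
weightCertificates 2 = ((1 ∷ 1 ∷ []) , 2) ∷ ((0 ∷ 1 ∷ []) , 1) ∷ []
weightCertificates 3 = ((1 ∷ 1 ∷ 1 ∷ []) , 3) ∷ ((0 ∷ 1 ∷ 1 ∷ []) , 2) ∷ ((1 ∷ 1 ∷ 2 ∷ []) , 3) ∷
  ((1 ∷ 1 ∷ 1 ∷ []) , 2) ∷ ((0 ∷ 0 ∷ 1 ∷ []) , 1) ∷ []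
weightCertificates 4 = ((1 ∷ 1 ∷ 1 ∷ 1 ∷ []) , 4) ∷ ((0 ∷ 1 ∷ 1 ∷ 1 ∷ []) , 3) ∷ ((1 ∷ 1 ∷ 2 ∷ 2 ∷ []) , 5) ∷
  ((1 ∷ 1 ∷ 1 ∷ 2 ∷ []) , 4) ∷ ((1 ∷ 1 ∷ 1 ∷ 1 ∷ []) , 3) ∷ ((0 ∷ 0 ∷ 1 ∷ 1 ∷ []) , 2) ∷
  ((1 ∷ 1 ∷ 2 ∷ 3 ∷ []) , 5) ∷ ((1 ∷ 1 ∷ 2 ∷ 2 ∷ []) , 4) ∷ ((0 ∷ 1 ∷ 1 ∷ 2 ∷ []) , 3) ∷
  ((1 ∷ 2 ∷ 2 ∷ 3 ∷ []) , 5) ∷ ((0 ∷ 1 ∷ 1 ∷ 1 ∷ []) , 2) ∷ ((1 ∷ 1 ∷ 1 ∷ 3 ∷ []) , 4) ∷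
  ((1 ∷ 1 ∷ 1 ∷ 2 ∷ []) , 3) ∷ ((0 ∷ 0 ∷ 0 ∷ 1 ∷ []) , 1) ∷ []
weightCertificates 5 = ((1 ∷ 1 ∷ 1 ∷ 1 ∷ 1 ∷ []) , 5) ∷ ((0 ∷ 1 ∷ 1 ∷ 1 ∷ 1 ∷ []) , 4) ∷
  ((1 ∷ 1 ∷ 2 ∷ 2 ∷ 2 ∷ []) , 7) ∷ ((1 ∷ 1 ∷ 1 ∷ 2 ∷ 2 ∷ []) , 6) ∷ ((1 ∷ 1 ∷ 1 ∷ 1 ∷ 2 ∷ []) , 5) ∷
  ((1 ∷ 1 ∷ 1 ∷ 1 ∷ 1 ∷ []) , 4) ∷ ((0 ∷ 0 ∷ 1 ∷ 1 ∷ 1 ∷ []) , 3) ∷ ((1 ∷ 1 ∷ 2 ∷ 3 ∷ 3 ∷ []) , 8) ∷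
  ((1 ∷ 1 ∷ 2 ∷ 2 ∷ 3 ∷ []) , 7) ∷ ((1 ∷ 1 ∷ 2 ∷ 2 ∷ 2 ∷ []) , 6) ∷ ((0 ∷ 1 ∷ 1 ∷ 2 ∷ 2 ∷ []) , 5) ∷
  ((1 ∷ 2 ∷ 2 ∷ 3 ∷ 4 ∷ []) , 9) ∷ ((1 ∷ 2 ∷ 2 ∷ 3 ∷ 3 ∷ []) , 8) ∷ ((0 ∷ 1 ∷ 1 ∷ 1 ∷ 2 ∷ []) , 4) ∷
  ((1 ∷ 2 ∷ 2 ∷ 2 ∷ 3 ∷ []) , 7) ∷ ((0 ∷ 1 ∷ 1 ∷ 1 ∷ 1 ∷ []) , 3) ∷ ((1 ∷ 1 ∷ 1 ∷ 3 ∷ 3 ∷ []) , 7) ∷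
  ((1 ∷ 1 ∷ 1 ∷ 2 ∷ 3 ∷ []) , 6) ∷ ((1 ∷ 1 ∷ 1 ∷ 2 ∷ 2 ∷ []) , 5) ∷ ((1 ∷ 2 ∷ 2 ∷ 3 ∷ 5 ∷ []) , 9) ∷
  ((1 ∷ 2 ∷ 2 ∷ 3 ∷ 4 ∷ []) , 8) ∷ ((1 ∷ 2 ∷ 2 ∷ 3 ∷ 3 ∷ []) , 7) ∷ ((1 ∷ 1 ∷ 2 ∷ 2 ∷ 4 ∷ []) , 7) ∷
  ((1 ∷ 1 ∷ 2 ∷ 2 ∷ 3 ∷ []) , 6) ∷ ((1 ∷ 2 ∷ 3 ∷ 3 ∷ 4 ∷ []) , 8) ∷ ((1 ∷ 1 ∷ 2 ∷ 2 ∷ 2 ∷ []) , 5) ∷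
  ((1 ∷ 1 ∷ 1 ∷ 1 ∷ 3 ∷ []) , 5) ∷ ((1 ∷ 1 ∷ 1 ∷ 1 ∷ 2 ∷ []) , 4) ∷ ((1 ∷ 2 ∷ 2 ∷ 2 ∷ 3 ∷ []) , 6) ∷
  ((2 ∷ 2 ∷ 3 ∷ 3 ∷ 4 ∷ []) , 8) ∷ ((2 ∷ 2 ∷ 2 ∷ 3 ∷ 3 ∷ []) , 7) ∷ ((1 ∷ 1 ∷ 1 ∷ 1 ∷ 1 ∷ []) , 3) ∷
  ((0 ∷ 0 ∷ 0 ∷ 1 ∷ 1 ∷ []) , 2) ∷ ((1 ∷ 1 ∷ 1 ∷ 3 ∷ 4 ∷ []) , 7) ∷ ((1 ∷ 1 ∷ 1 ∷ 3 ∷ 3 ∷ []) , 6) ∷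
  ((0 ∷ 1 ∷ 1 ∷ 2 ∷ 3 ∷ []) , 5) ∷ ((1 ∷ 2 ∷ 2 ∷ 4 ∷ 5 ∷ []) , 9) ∷ ((0 ∷ 1 ∷ 1 ∷ 2 ∷ 2 ∷ []) , 4) ∷
  ((1 ∷ 1 ∷ 2 ∷ 3 ∷ 5 ∷ []) , 8) ∷ ((1 ∷ 1 ∷ 2 ∷ 3 ∷ 4 ∷ []) , 7) ∷ ((1 ∷ 2 ∷ 3 ∷ 4 ∷ 5 ∷ []) , 9) ∷
  ((1 ∷ 1 ∷ 2 ∷ 3 ∷ 3 ∷ []) , 6) ∷ ((1 ∷ 1 ∷ 1 ∷ 2 ∷ 4 ∷ []) , 6) ∷ ((1 ∷ 1 ∷ 1 ∷ 2 ∷ 3 ∷ []) , 5) ∷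
  ((1 ∷ 2 ∷ 2 ∷ 3 ∷ 4 ∷ []) , 7) ∷ ((2 ∷ 2 ∷ 3 ∷ 4 ∷ 5 ∷ []) , 9) ∷ ((1 ∷ 1 ∷ 1 ∷ 2 ∷ 2 ∷ []) , 4) ∷
  ((0 ∷ 0 ∷ 1 ∷ 1 ∷ 2 ∷ []) , 3) ∷ ((1 ∷ 1 ∷ 3 ∷ 3 ∷ 5 ∷ []) , 8) ∷ ((0 ∷ 1 ∷ 2 ∷ 2 ∷ 3 ∷ []) , 5) ∷
  ((1 ∷ 1 ∷ 3 ∷ 3 ∷ 4 ∷ []) , 7) ∷ ((0 ∷ 0 ∷ 1 ∷ 1 ∷ 1 ∷ []) , 2) ∷ ((1 ∷ 1 ∷ 2 ∷ 2 ∷ 5 ∷ []) , 7) ∷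
  ((1 ∷ 1 ∷ 2 ∷ 2 ∷ 4 ∷ []) , 6) ∷ ((1 ∷ 2 ∷ 3 ∷ 3 ∷ 5 ∷ []) , 8) ∷ ((1 ∷ 1 ∷ 2 ∷ 2 ∷ 3 ∷ []) , 5) ∷
  ((0 ∷ 1 ∷ 1 ∷ 1 ∷ 3 ∷ []) , 4) ∷ ((1 ∷ 2 ∷ 2 ∷ 2 ∷ 5 ∷ []) , 7) ∷ ((0 ∷ 1 ∷ 1 ∷ 1 ∷ 2 ∷ []) , 3) ∷
  ((1 ∷ 1 ∷ 1 ∷ 1 ∷ 4 ∷ []) , 5) ∷ ((1 ∷ 1 ∷ 1 ∷ 1 ∷ 3 ∷ []) , 4) ∷ ((0 ∷ 0 ∷ 0 ∷ 0 ∷ 1 ∷ []) , 1) ∷ []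
weightCertificates 6 = ((1 ∷ 1 ∷ 1 ∷ 1 ∷ 1 ∷ 1 ∷ []) , 6) ∷ ((0 ∷ 1 ∷ 1 ∷ 1 ∷ 1 ∷ 1 ∷ []) , 5) ∷
  ((1 ∷ 1 ∷ 2 ∷ 2 ∷ 2 ∷ 2 ∷ []) , 9) ∷ ((1 ∷ 1 ∷ 1 ∷ 2 ∷ 2 ∷ 2 ∷ []) , 8) ∷ ((1 ∷ 1 ∷ 1 ∷ 1 ∷ 2 ∷ 2 ∷ []) , 7) ∷
  ((1 ∷ 1 ∷ 1 ∷ 1 ∷ 1 ∷ 2 ∷ []) , 6) ∷ ((1 ∷ 1 ∷ 1 ∷ 1 ∷ 1 ∷ 1 ∷ []) , 5) ∷ ((0 ∷ 0 ∷ 1 ∷ 1 ∷ 1 ∷ 1 ∷ []) , 4) ∷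
  ((1 ∷ 1 ∷ 2 ∷ 3 ∷ 3 ∷ 3 ∷ []) , 11) ∷ ((1 ∷ 1 ∷ 2 ∷ 2 ∷ 3 ∷ 3 ∷ []) , 10) ∷
  ((1 ∷ 1 ∷ 2 ∷ 2 ∷ 2 ∷ 3 ∷ []) , 9) ∷ ((1 ∷ 1 ∷ 2 ∷ 2 ∷ 2 ∷ 2 ∷ []) , 8) ∷ ((0 ∷ 1 ∷ 1 ∷ 2 ∷ 2 ∷ 2 ∷ []) , 7) ∷
  ((1 ∷ 2 ∷ 2 ∷ 3 ∷ 4 ∷ 4 ∷ []) , 13) ∷ ((1 ∷ 2 ∷ 2 ∷ 3 ∷ 3 ∷ 4 ∷ []) , 12) ∷
  ((1 ∷ 2 ∷ 2 ∷ 3 ∷ 3 ∷ 3 ∷ []) , 11) ∷ ((0 ∷ 1 ∷ 1 ∷ 1 ∷ 2 ∷ 2 ∷ []) , 6) ∷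
  ((1 ∷ 2 ∷ 2 ∷ 2 ∷ 3 ∷ 4 ∷ []) , 11) ∷ ((1 ∷ 2 ∷ 2 ∷ 2 ∷ 3 ∷ 3 ∷ []) , 10) ∷
  ((0 ∷ 1 ∷ 1 ∷ 1 ∷ 1 ∷ 2 ∷ []) , 5) ∷ ((1 ∷ 2 ∷ 2 ∷ 2 ∷ 2 ∷ 3 ∷ []) , 9) ∷ ((0 ∷ 1 ∷ 1 ∷ 1 ∷ 1 ∷ 1 ∷ []) , 4) ∷
  ((1 ∷ 1 ∷ 1 ∷ 3 ∷ 3 ∷ 3 ∷ []) , 10) ∷ ((1 ∷ 1 ∷ 1 ∷ 2 ∷ 3 ∷ 3 ∷ []) , 9) ∷
  ((1 ∷ 1 ∷ 1 ∷ 2 ∷ 2 ∷ 3 ∷ []) , 8) ∷ ((1 ∷ 1 ∷ 1 ∷ 2 ∷ 2 ∷ 2 ∷ []) , 7) ∷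
  ((1 ∷ 2 ∷ 2 ∷ 3 ∷ 5 ∷ 5 ∷ []) , 14) ∷ ((1 ∷ 2 ∷ 2 ∷ 3 ∷ 4 ∷ 5 ∷ []) , 13) ∷
  ((1 ∷ 2 ∷ 2 ∷ 3 ∷ 4 ∷ 4 ∷ []) , 12) ∷ ((1 ∷ 2 ∷ 2 ∷ 3 ∷ 3 ∷ 5 ∷ []) , 12) ∷
  ((1 ∷ 2 ∷ 2 ∷ 3 ∷ 3 ∷ 4 ∷ []) , 11) ∷ ((1 ∷ 2 ∷ 2 ∷ 3 ∷ 3 ∷ 3 ∷ []) , 10) ∷
  ((1 ∷ 1 ∷ 2 ∷ 2 ∷ 4 ∷ 4 ∷ []) , 11) ∷ ((1 ∷ 1 ∷ 2 ∷ 2 ∷ 3 ∷ 4 ∷ []) , 10) ∷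
  ((1 ∷ 1 ∷ 2 ∷ 2 ∷ 3 ∷ 3 ∷ []) , 9) ∷ ((1 ∷ 2 ∷ 3 ∷ 3 ∷ 4 ∷ 6 ∷ []) , 14) ∷
  ((1 ∷ 2 ∷ 3 ∷ 3 ∷ 4 ∷ 5 ∷ []) , 13) ∷ ((1 ∷ 2 ∷ 3 ∷ 3 ∷ 4 ∷ 4 ∷ []) , 12) ∷
  ((1 ∷ 1 ∷ 2 ∷ 2 ∷ 2 ∷ 4 ∷ []) , 9) ∷ ((1 ∷ 1 ∷ 2 ∷ 2 ∷ 2 ∷ 3 ∷ []) , 8) ∷
  ((1 ∷ 2 ∷ 3 ∷ 3 ∷ 3 ∷ 4 ∷ []) , 11) ∷ ((1 ∷ 1 ∷ 2 ∷ 2 ∷ 2 ∷ 2 ∷ []) , 7) ∷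
  ((1 ∷ 1 ∷ 1 ∷ 1 ∷ 3 ∷ 3 ∷ []) , 8) ∷ ((1 ∷ 1 ∷ 1 ∷ 1 ∷ 2 ∷ 3 ∷ []) , 7) ∷ ((1 ∷ 1 ∷ 1 ∷ 1 ∷ 2 ∷ 2 ∷ []) , 6) ∷
  ((1 ∷ 2 ∷ 2 ∷ 2 ∷ 3 ∷ 5 ∷ []) , 11) ∷ ((1 ∷ 2 ∷ 2 ∷ 2 ∷ 3 ∷ 4 ∷ []) , 10) ∷
  ((1 ∷ 2 ∷ 2 ∷ 2 ∷ 3 ∷ 3 ∷ []) , 9) ∷ ((2 ∷ 2 ∷ 3 ∷ 3 ∷ 4 ∷ 7 ∷ []) , 15) ∷
  ((2 ∷ 2 ∷ 3 ∷ 3 ∷ 4 ∷ 5 ∷ []) , 13) ∷ ((2 ∷ 3 ∷ 4 ∷ 4 ∷ 5 ∷ 6 ∷ []) , 16) ∷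
  ((2 ∷ 2 ∷ 3 ∷ 3 ∷ 4 ∷ 4 ∷ []) , 12) ∷ ((2 ∷ 2 ∷ 2 ∷ 3 ∷ 3 ∷ 6 ∷ []) , 13) ∷
  ((2 ∷ 2 ∷ 2 ∷ 3 ∷ 3 ∷ 4 ∷ []) , 11) ∷ ((2 ∷ 3 ∷ 3 ∷ 4 ∷ 4 ∷ 5 ∷ []) , 14) ∷
  ((3 ∷ 3 ∷ 4 ∷ 5 ∷ 5 ∷ 6 ∷ []) , 17) ∷ ((2 ∷ 2 ∷ 2 ∷ 3 ∷ 3 ∷ 3 ∷ []) , 10) ∷
  ((1 ∷ 1 ∷ 1 ∷ 1 ∷ 1 ∷ 3 ∷ []) , 6) ∷ ((1 ∷ 1 ∷ 1 ∷ 1 ∷ 1 ∷ 2 ∷ []) , 5) ∷ ((1 ∷ 2 ∷ 2 ∷ 2 ∷ 2 ∷ 3 ∷ []) , 8) ∷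
  ((2 ∷ 2 ∷ 3 ∷ 3 ∷ 3 ∷ 4 ∷ []) , 11) ∷ ((3 ∷ 3 ∷ 3 ∷ 4 ∷ 4 ∷ 5 ∷ []) , 14) ∷
  ((2 ∷ 2 ∷ 2 ∷ 2 ∷ 3 ∷ 3 ∷ []) , 9) ∷ ((1 ∷ 1 ∷ 1 ∷ 1 ∷ 1 ∷ 1 ∷ []) , 4) ∷ ((0 ∷ 0 ∷ 0 ∷ 1 ∷ 1 ∷ 1 ∷ []) , 3) ∷
  ((1 ∷ 1 ∷ 1 ∷ 3 ∷ 4 ∷ 4 ∷ []) , 11) ∷ ((1 ∷ 1 ∷ 1 ∷ 3 ∷ 3 ∷ 4 ∷ []) , 10) ∷
  ((1 ∷ 1 ∷ 1 ∷ 3 ∷ 3 ∷ 3 ∷ []) , 9) ∷ ((0 ∷ 1 ∷ 1 ∷ 2 ∷ 3 ∷ 3 ∷ []) , 8) ∷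
  ((1 ∷ 2 ∷ 2 ∷ 4 ∷ 5 ∷ 6 ∷ []) , 15) ∷ ((1 ∷ 2 ∷ 2 ∷ 4 ∷ 5 ∷ 5 ∷ []) , 14) ∷
  ((0 ∷ 1 ∷ 1 ∷ 2 ∷ 2 ∷ 3 ∷ []) , 7) ∷ ((1 ∷ 2 ∷ 2 ∷ 4 ∷ 4 ∷ 5 ∷ []) , 13) ∷
  ((0 ∷ 1 ∷ 1 ∷ 2 ∷ 2 ∷ 2 ∷ []) , 6) ∷ ((1 ∷ 1 ∷ 2 ∷ 3 ∷ 5 ∷ 5 ∷ []) , 13) ∷
  ((1 ∷ 1 ∷ 2 ∷ 3 ∷ 4 ∷ 5 ∷ []) , 12) ∷ ((1 ∷ 1 ∷ 2 ∷ 3 ∷ 4 ∷ 4 ∷ []) , 11) ∷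
  ((1 ∷ 2 ∷ 3 ∷ 4 ∷ 5 ∷ 7 ∷ []) , 16) ∷ ((1 ∷ 2 ∷ 3 ∷ 4 ∷ 5 ∷ 6 ∷ []) , 15) ∷
  ((1 ∷ 2 ∷ 3 ∷ 4 ∷ 5 ∷ 5 ∷ []) , 14) ∷ ((1 ∷ 1 ∷ 2 ∷ 3 ∷ 3 ∷ 5 ∷ []) , 11) ∷
  ((1 ∷ 1 ∷ 2 ∷ 3 ∷ 3 ∷ 4 ∷ []) , 10) ∷ ((1 ∷ 2 ∷ 3 ∷ 4 ∷ 4 ∷ 5 ∷ []) , 13) ∷
  ((1 ∷ 1 ∷ 2 ∷ 3 ∷ 3 ∷ 3 ∷ []) , 9) ∷ ((1 ∷ 1 ∷ 1 ∷ 2 ∷ 4 ∷ 4 ∷ []) , 10) ∷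
  ((1 ∷ 1 ∷ 1 ∷ 2 ∷ 3 ∷ 4 ∷ []) , 9) ∷ ((1 ∷ 1 ∷ 1 ∷ 2 ∷ 3 ∷ 3 ∷ []) , 8) ∷
  ((1 ∷ 2 ∷ 2 ∷ 3 ∷ 4 ∷ 6 ∷ []) , 13) ∷ ((1 ∷ 2 ∷ 2 ∷ 3 ∷ 4 ∷ 5 ∷ []) , 12) ∷
  ((1 ∷ 2 ∷ 2 ∷ 3 ∷ 4 ∷ 4 ∷ []) , 11) ∷ ((2 ∷ 2 ∷ 3 ∷ 4 ∷ 5 ∷ 8 ∷ []) , 17) ∷
  ((2 ∷ 2 ∷ 3 ∷ 4 ∷ 5 ∷ 6 ∷ []) , 15) ∷ ((2 ∷ 3 ∷ 4 ∷ 5 ∷ 6 ∷ 7 ∷ []) , 18) ∷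
  ((2 ∷ 2 ∷ 3 ∷ 4 ∷ 5 ∷ 5 ∷ []) , 14) ∷ ((1 ∷ 1 ∷ 1 ∷ 2 ∷ 2 ∷ 4 ∷ []) , 8) ∷
  ((1 ∷ 1 ∷ 1 ∷ 2 ∷ 2 ∷ 3 ∷ []) , 7) ∷ ((1 ∷ 2 ∷ 2 ∷ 3 ∷ 3 ∷ 4 ∷ []) , 10) ∷
  ((2 ∷ 2 ∷ 3 ∷ 4 ∷ 4 ∷ 5 ∷ []) , 13) ∷ ((1 ∷ 1 ∷ 1 ∷ 2 ∷ 2 ∷ 2 ∷ []) , 6) ∷
  ((2 ∷ 2 ∷ 2 ∷ 3 ∷ 3 ∷ 7 ∷ []) , 13) ∷ ((2 ∷ 2 ∷ 2 ∷ 3 ∷ 3 ∷ 5 ∷ []) , 11) ∷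
  ((2 ∷ 3 ∷ 3 ∷ 4 ∷ 4 ∷ 6 ∷ []) , 14) ∷ ((3 ∷ 3 ∷ 4 ∷ 5 ∷ 5 ∷ 7 ∷ []) , 17) ∷
  ((2 ∷ 2 ∷ 2 ∷ 3 ∷ 3 ∷ 4 ∷ []) , 10) ∷ ((3 ∷ 3 ∷ 3 ∷ 4 ∷ 5 ∷ 5 ∷ []) , 14) ∷
  ((2 ∷ 2 ∷ 2 ∷ 3 ∷ 3 ∷ 3 ∷ []) , 9) ∷ ((0 ∷ 0 ∷ 1 ∷ 1 ∷ 2 ∷ 2 ∷ []) , 5) ∷
  ((1 ∷ 1 ∷ 3 ∷ 3 ∷ 5 ∷ 6 ∷ []) , 14) ∷ ((1 ∷ 1 ∷ 3 ∷ 3 ∷ 5 ∷ 5 ∷ []) , 13) ∷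
  ((0 ∷ 1 ∷ 2 ∷ 2 ∷ 3 ∷ 4 ∷ []) , 9) ∷ ((1 ∷ 2 ∷ 4 ∷ 4 ∷ 6 ∷ 7 ∷ []) , 17) ∷
  ((0 ∷ 1 ∷ 2 ∷ 2 ∷ 3 ∷ 3 ∷ []) , 8) ∷ ((1 ∷ 1 ∷ 3 ∷ 3 ∷ 4 ∷ 6 ∷ []) , 13) ∷
  ((1 ∷ 1 ∷ 3 ∷ 3 ∷ 4 ∷ 5 ∷ []) , 12) ∷ ((1 ∷ 2 ∷ 4 ∷ 4 ∷ 5 ∷ 6 ∷ []) , 15) ∷
  ((1 ∷ 1 ∷ 3 ∷ 3 ∷ 4 ∷ 4 ∷ []) , 11) ∷ ((0 ∷ 0 ∷ 1 ∷ 1 ∷ 1 ∷ 2 ∷ []) , 4) ∷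
  ((1 ∷ 1 ∷ 3 ∷ 3 ∷ 3 ∷ 5 ∷ []) , 11) ∷ ((0 ∷ 1 ∷ 2 ∷ 2 ∷ 2 ∷ 3 ∷ []) , 7) ∷
  ((1 ∷ 1 ∷ 3 ∷ 3 ∷ 3 ∷ 4 ∷ []) , 10) ∷ ((0 ∷ 0 ∷ 1 ∷ 1 ∷ 1 ∷ 1 ∷ []) , 3) ∷
  ((1 ∷ 1 ∷ 2 ∷ 2 ∷ 5 ∷ 5 ∷ []) , 12) ∷ ((1 ∷ 1 ∷ 2 ∷ 2 ∷ 4 ∷ 5 ∷ []) , 11) ∷
  ((1 ∷ 1 ∷ 2 ∷ 2 ∷ 4 ∷ 4 ∷ []) , 10) ∷ ((1 ∷ 2 ∷ 3 ∷ 3 ∷ 5 ∷ 7 ∷ []) , 15) ∷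
  ((1 ∷ 2 ∷ 3 ∷ 3 ∷ 5 ∷ 6 ∷ []) , 14) ∷ ((1 ∷ 2 ∷ 3 ∷ 3 ∷ 5 ∷ 5 ∷ []) , 13) ∷
  ((1 ∷ 1 ∷ 2 ∷ 2 ∷ 3 ∷ 5 ∷ []) , 10) ∷ ((1 ∷ 1 ∷ 2 ∷ 2 ∷ 3 ∷ 4 ∷ []) , 9) ∷
  ((1 ∷ 2 ∷ 3 ∷ 3 ∷ 4 ∷ 5 ∷ []) , 12) ∷ ((1 ∷ 1 ∷ 2 ∷ 2 ∷ 3 ∷ 3 ∷ []) , 8) ∷
  ((2 ∷ 2 ∷ 3 ∷ 4 ∷ 5 ∷ 9 ∷ []) , 17) ∷ ((2 ∷ 2 ∷ 3 ∷ 4 ∷ 5 ∷ 7 ∷ []) , 15) ∷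
  ((2 ∷ 3 ∷ 4 ∷ 5 ∷ 6 ∷ 8 ∷ []) , 18) ∷ ((2 ∷ 2 ∷ 3 ∷ 4 ∷ 5 ∷ 6 ∷ []) , 14) ∷
  ((2 ∷ 2 ∷ 3 ∷ 4 ∷ 5 ∷ 5 ∷ []) , 13) ∷ ((2 ∷ 2 ∷ 3 ∷ 3 ∷ 4 ∷ 8 ∷ []) , 15) ∷
  ((2 ∷ 2 ∷ 3 ∷ 3 ∷ 4 ∷ 6 ∷ []) , 13) ∷ ((2 ∷ 3 ∷ 4 ∷ 4 ∷ 5 ∷ 7 ∷ []) , 16) ∷
  ((2 ∷ 2 ∷ 3 ∷ 3 ∷ 4 ∷ 5 ∷ []) , 12) ∷ ((3 ∷ 3 ∷ 4 ∷ 5 ∷ 6 ∷ 7 ∷ []) , 17) ∷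
  ((2 ∷ 2 ∷ 3 ∷ 3 ∷ 4 ∷ 4 ∷ []) , 11) ∷ ((3 ∷ 3 ∷ 4 ∷ 4 ∷ 5 ∷ 5 ∷ []) , 14) ∷
  ((1 ∷ 1 ∷ 3 ∷ 3 ∷ 4 ∷ 7 ∷ []) , 13) ∷ ((1 ∷ 1 ∷ 3 ∷ 3 ∷ 4 ∷ 6 ∷ []) , 12) ∷
  ((1 ∷ 2 ∷ 4 ∷ 4 ∷ 5 ∷ 7 ∷ []) , 15) ∷ ((1 ∷ 1 ∷ 3 ∷ 3 ∷ 4 ∷ 5 ∷ []) , 11) ∷
  ((1 ∷ 1 ∷ 3 ∷ 3 ∷ 4 ∷ 4 ∷ []) , 10) ∷ ((1 ∷ 1 ∷ 2 ∷ 3 ∷ 3 ∷ 6 ∷ []) , 11) ∷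
  ((1 ∷ 1 ∷ 2 ∷ 3 ∷ 3 ∷ 5 ∷ []) , 10) ∷ ((1 ∷ 2 ∷ 3 ∷ 4 ∷ 4 ∷ 6 ∷ []) , 13) ∷
  ((1 ∷ 1 ∷ 2 ∷ 3 ∷ 3 ∷ 4 ∷ []) , 9) ∷ ((2 ∷ 2 ∷ 3 ∷ 5 ∷ 5 ∷ 6 ∷ []) , 14) ∷
  ((1 ∷ 1 ∷ 3 ∷ 4 ∷ 4 ∷ 5 ∷ []) , 11) ∷ ((1 ∷ 1 ∷ 2 ∷ 3 ∷ 3 ∷ 3 ∷ []) , 8) ∷
  ((1 ∷ 1 ∷ 2 ∷ 2 ∷ 2 ∷ 5 ∷ []) , 9) ∷ ((1 ∷ 1 ∷ 2 ∷ 2 ∷ 2 ∷ 4 ∷ []) , 8) ∷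
  ((1 ∷ 2 ∷ 3 ∷ 3 ∷ 3 ∷ 5 ∷ []) , 11) ∷ ((1 ∷ 1 ∷ 2 ∷ 2 ∷ 2 ∷ 3 ∷ []) , 7) ∷
  ((2 ∷ 2 ∷ 3 ∷ 4 ∷ 4 ∷ 5 ∷ []) , 12) ∷ ((3 ∷ 3 ∷ 5 ∷ 5 ∷ 6 ∷ 7 ∷ []) , 17) ∷
  ((2 ∷ 2 ∷ 3 ∷ 3 ∷ 3 ∷ 4 ∷ []) , 10) ∷ ((1 ∷ 1 ∷ 3 ∷ 3 ∷ 3 ∷ 4 ∷ []) , 9) ∷
  ((2 ∷ 2 ∷ 4 ∷ 5 ∷ 5 ∷ 6 ∷ []) , 14) ∷ ((2 ∷ 2 ∷ 4 ∷ 4 ∷ 5 ∷ 5 ∷ []) , 13) ∷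
  ((1 ∷ 1 ∷ 2 ∷ 2 ∷ 2 ∷ 2 ∷ []) , 6) ∷ ((0 ∷ 1 ∷ 1 ∷ 1 ∷ 3 ∷ 3 ∷ []) , 7) ∷
  ((1 ∷ 2 ∷ 2 ∷ 2 ∷ 5 ∷ 6 ∷ []) , 13) ∷ ((1 ∷ 2 ∷ 2 ∷ 2 ∷ 5 ∷ 5 ∷ []) , 12) ∷
  ((0 ∷ 1 ∷ 1 ∷ 1 ∷ 2 ∷ 3 ∷ []) , 6) ∷ ((1 ∷ 2 ∷ 2 ∷ 2 ∷ 4 ∷ 5 ∷ []) , 11) ∷
  ((0 ∷ 1 ∷ 1 ∷ 1 ∷ 2 ∷ 2 ∷ []) , 5) ∷ ((1 ∷ 2 ∷ 3 ∷ 3 ∷ 5 ∷ 8 ∷ []) , 15) ∷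
  ((1 ∷ 2 ∷ 3 ∷ 3 ∷ 5 ∷ 7 ∷ []) , 14) ∷ ((1 ∷ 2 ∷ 3 ∷ 3 ∷ 5 ∷ 6 ∷ []) , 13) ∷
  ((1 ∷ 2 ∷ 3 ∷ 3 ∷ 5 ∷ 5 ∷ []) , 12) ∷ ((1 ∷ 2 ∷ 2 ∷ 3 ∷ 4 ∷ 7 ∷ []) , 13) ∷
  ((1 ∷ 2 ∷ 2 ∷ 3 ∷ 4 ∷ 6 ∷ []) , 12) ∷ ((1 ∷ 2 ∷ 2 ∷ 3 ∷ 4 ∷ 5 ∷ []) , 11) ∷
  ((2 ∷ 3 ∷ 4 ∷ 5 ∷ 7 ∷ 8 ∷ []) , 18) ∷ ((1 ∷ 2 ∷ 2 ∷ 3 ∷ 4 ∷ 4 ∷ []) , 10) ∷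
  ((1 ∷ 2 ∷ 2 ∷ 2 ∷ 3 ∷ 6 ∷ []) , 11) ∷ ((1 ∷ 2 ∷ 2 ∷ 2 ∷ 3 ∷ 5 ∷ []) , 10) ∷
  ((1 ∷ 2 ∷ 2 ∷ 2 ∷ 3 ∷ 4 ∷ []) , 9) ∷ ((2 ∷ 3 ∷ 4 ∷ 4 ∷ 6 ∷ 7 ∷ []) , 16) ∷
  ((2 ∷ 3 ∷ 3 ∷ 4 ∷ 5 ∷ 6 ∷ []) , 14) ∷ ((1 ∷ 2 ∷ 2 ∷ 2 ∷ 3 ∷ 3 ∷ []) , 8) ∷
  ((2 ∷ 3 ∷ 3 ∷ 3 ∷ 4 ∷ 4 ∷ []) , 11) ∷ ((0 ∷ 1 ∷ 2 ∷ 2 ∷ 3 ∷ 5 ∷ []) , 9) ∷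
  ((1 ∷ 2 ∷ 4 ∷ 4 ∷ 6 ∷ 9 ∷ []) , 17) ∷ ((0 ∷ 1 ∷ 2 ∷ 2 ∷ 3 ∷ 4 ∷ []) , 8) ∷
  ((1 ∷ 2 ∷ 4 ∷ 4 ∷ 6 ∷ 7 ∷ []) , 15) ∷ ((0 ∷ 1 ∷ 2 ∷ 2 ∷ 3 ∷ 3 ∷ []) , 7) ∷
  ((1 ∷ 2 ∷ 3 ∷ 4 ∷ 5 ∷ 9 ∷ []) , 16) ∷ ((1 ∷ 2 ∷ 3 ∷ 4 ∷ 5 ∷ 8 ∷ []) , 15) ∷
  ((1 ∷ 2 ∷ 3 ∷ 4 ∷ 5 ∷ 7 ∷ []) , 14) ∷ ((1 ∷ 2 ∷ 3 ∷ 4 ∷ 5 ∷ 6 ∷ []) , 13) ∷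
  ((2 ∷ 3 ∷ 4 ∷ 6 ∷ 7 ∷ 8 ∷ []) , 18) ∷ ((1 ∷ 2 ∷ 4 ∷ 5 ∷ 6 ∷ 7 ∷ []) , 15) ∷
  ((1 ∷ 2 ∷ 3 ∷ 4 ∷ 5 ∷ 5 ∷ []) , 12) ∷ ((1 ∷ 2 ∷ 3 ∷ 3 ∷ 4 ∷ 8 ∷ []) , 14) ∷
  ((1 ∷ 2 ∷ 3 ∷ 3 ∷ 4 ∷ 7 ∷ []) , 13) ∷ ((1 ∷ 2 ∷ 3 ∷ 3 ∷ 4 ∷ 6 ∷ []) , 12) ∷
  ((1 ∷ 2 ∷ 3 ∷ 3 ∷ 4 ∷ 5 ∷ []) , 11) ∷ ((2 ∷ 3 ∷ 4 ∷ 5 ∷ 6 ∷ 7 ∷ []) , 16) ∷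
  ((2 ∷ 3 ∷ 4 ∷ 4 ∷ 5 ∷ 6 ∷ []) , 14) ∷ ((3 ∷ 4 ∷ 5 ∷ 5 ∷ 6 ∷ 7 ∷ []) , 17) ∷
  ((1 ∷ 2 ∷ 4 ∷ 4 ∷ 5 ∷ 6 ∷ []) , 13) ∷ ((2 ∷ 3 ∷ 5 ∷ 6 ∷ 7 ∷ 8 ∷ []) , 18) ∷
  ((1 ∷ 2 ∷ 3 ∷ 3 ∷ 4 ∷ 4 ∷ []) , 10) ∷ ((2 ∷ 3 ∷ 4 ∷ 4 ∷ 5 ∷ 5 ∷ []) , 13) ∷
  ((0 ∷ 1 ∷ 1 ∷ 2 ∷ 2 ∷ 4 ∷ []) , 7) ∷ ((1 ∷ 2 ∷ 2 ∷ 4 ∷ 4 ∷ 7 ∷ []) , 13) ∷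
  ((0 ∷ 1 ∷ 1 ∷ 2 ∷ 2 ∷ 3 ∷ []) , 6) ∷ ((1 ∷ 2 ∷ 3 ∷ 5 ∷ 5 ∷ 7 ∷ []) , 14) ∷
  ((1 ∷ 2 ∷ 2 ∷ 4 ∷ 4 ∷ 5 ∷ []) , 11) ∷ ((0 ∷ 1 ∷ 2 ∷ 3 ∷ 3 ∷ 4 ∷ []) , 8) ∷
  ((1 ∷ 2 ∷ 3 ∷ 5 ∷ 5 ∷ 6 ∷ []) , 13) ∷ ((0 ∷ 1 ∷ 1 ∷ 2 ∷ 2 ∷ 2 ∷ []) , 5) ∷
  ((1 ∷ 2 ∷ 2 ∷ 3 ∷ 3 ∷ 7 ∷ []) , 12) ∷ ((1 ∷ 2 ∷ 2 ∷ 3 ∷ 3 ∷ 6 ∷ []) , 11) ∷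
  ((1 ∷ 2 ∷ 2 ∷ 3 ∷ 3 ∷ 5 ∷ []) , 10) ∷ ((1 ∷ 2 ∷ 3 ∷ 4 ∷ 4 ∷ 6 ∷ []) , 12) ∷
  ((1 ∷ 2 ∷ 2 ∷ 3 ∷ 3 ∷ 4 ∷ []) , 9) ∷ ((2 ∷ 4 ∷ 4 ∷ 5 ∷ 6 ∷ 7 ∷ []) , 16) ∷
  ((2 ∷ 3 ∷ 3 ∷ 4 ∷ 4 ∷ 5 ∷ []) , 12) ∷ ((1 ∷ 2 ∷ 4 ∷ 5 ∷ 5 ∷ 7 ∷ []) , 14) ∷
  ((1 ∷ 2 ∷ 3 ∷ 4 ∷ 4 ∷ 5 ∷ []) , 11) ∷ ((2 ∷ 4 ∷ 5 ∷ 6 ∷ 7 ∷ 8 ∷ []) , 18) ∷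
  ((2 ∷ 3 ∷ 4 ∷ 5 ∷ 5 ∷ 6 ∷ []) , 14) ∷ ((1 ∷ 3 ∷ 3 ∷ 5 ∷ 5 ∷ 6 ∷ []) , 13) ∷
  ((1 ∷ 3 ∷ 3 ∷ 4 ∷ 5 ∷ 5 ∷ []) , 12) ∷ ((1 ∷ 2 ∷ 2 ∷ 3 ∷ 3 ∷ 3 ∷ []) , 8) ∷
  ((0 ∷ 1 ∷ 1 ∷ 1 ∷ 1 ∷ 3 ∷ []) , 5) ∷ ((1 ∷ 2 ∷ 2 ∷ 2 ∷ 2 ∷ 5 ∷ []) , 9) ∷ ((0 ∷ 1 ∷ 1 ∷ 1 ∷ 1 ∷ 2 ∷ []) , 4) ∷
  ((1 ∷ 2 ∷ 3 ∷ 3 ∷ 3 ∷ 5 ∷ []) , 10) ∷ ((1 ∷ 3 ∷ 3 ∷ 4 ∷ 4 ∷ 6 ∷ []) , 12) ∷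
  ((1 ∷ 3 ∷ 3 ∷ 3 ∷ 4 ∷ 5 ∷ []) , 11) ∷ ((1 ∷ 2 ∷ 2 ∷ 2 ∷ 2 ∷ 3 ∷ []) , 7) ∷
  ((0 ∷ 1 ∷ 2 ∷ 2 ∷ 2 ∷ 3 ∷ []) , 6) ∷ ((1 ∷ 3 ∷ 4 ∷ 5 ∷ 5 ∷ 7 ∷ []) , 14) ∷
  ((1 ∷ 3 ∷ 4 ∷ 4 ∷ 5 ∷ 6 ∷ []) , 13) ∷ ((1 ∷ 2 ∷ 3 ∷ 3 ∷ 3 ∷ 4 ∷ []) , 9) ∷
  ((0 ∷ 2 ∷ 2 ∷ 3 ∷ 3 ∷ 4 ∷ []) , 8) ∷ ((1 ∷ 4 ∷ 4 ∷ 5 ∷ 6 ∷ 7 ∷ []) , 15) ∷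
  ((1 ∷ 3 ∷ 3 ∷ 4 ∷ 4 ∷ 5 ∷ []) , 11) ∷ ((0 ∷ 2 ∷ 2 ∷ 2 ∷ 3 ∷ 3 ∷ []) , 7) ∷
  ((1 ∷ 3 ∷ 3 ∷ 3 ∷ 4 ∷ 4 ∷ []) , 10) ∷ ((0 ∷ 1 ∷ 1 ∷ 1 ∷ 1 ∷ 1 ∷ []) , 3) ∷
  ((1 ∷ 1 ∷ 1 ∷ 1 ∷ 4 ∷ 4 ∷ []) , 9) ∷ ((1 ∷ 1 ∷ 1 ∷ 1 ∷ 3 ∷ 4 ∷ []) , 8) ∷ ((1 ∷ 1 ∷ 1 ∷ 1 ∷ 3 ∷ 3 ∷ []) , 7) ∷
  ((1 ∷ 2 ∷ 2 ∷ 2 ∷ 5 ∷ 7 ∷ []) , 13) ∷ ((1 ∷ 2 ∷ 2 ∷ 2 ∷ 5 ∷ 6 ∷ []) , 12) ∷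
  ((1 ∷ 2 ∷ 2 ∷ 2 ∷ 5 ∷ 5 ∷ []) , 11) ∷ ((1 ∷ 1 ∷ 2 ∷ 2 ∷ 4 ∷ 6 ∷ []) , 11) ∷
  ((1 ∷ 1 ∷ 2 ∷ 2 ∷ 4 ∷ 5 ∷ []) , 10) ∷ ((1 ∷ 2 ∷ 3 ∷ 3 ∷ 6 ∷ 7 ∷ []) , 14) ∷
  ((1 ∷ 1 ∷ 2 ∷ 2 ∷ 4 ∷ 4 ∷ []) , 9) ∷ ((1 ∷ 1 ∷ 1 ∷ 2 ∷ 3 ∷ 5 ∷ []) , 9) ∷ ((1 ∷ 1 ∷ 1 ∷ 2 ∷ 3 ∷ 4 ∷ []) , 8) ∷
  ((1 ∷ 2 ∷ 2 ∷ 3 ∷ 5 ∷ 6 ∷ []) , 12) ∷ ((2 ∷ 2 ∷ 3 ∷ 4 ∷ 6 ∷ 7 ∷ []) , 15) ∷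
  ((1 ∷ 1 ∷ 1 ∷ 2 ∷ 3 ∷ 3 ∷ []) , 7) ∷ ((1 ∷ 1 ∷ 1 ∷ 1 ∷ 2 ∷ 4 ∷ []) , 7) ∷ ((1 ∷ 1 ∷ 1 ∷ 1 ∷ 2 ∷ 3 ∷ []) , 6) ∷
  ((1 ∷ 2 ∷ 2 ∷ 2 ∷ 4 ∷ 5 ∷ []) , 10) ∷ ((2 ∷ 2 ∷ 3 ∷ 3 ∷ 5 ∷ 6 ∷ []) , 13) ∷
  ((2 ∷ 2 ∷ 2 ∷ 3 ∷ 4 ∷ 5 ∷ []) , 11) ∷ ((1 ∷ 1 ∷ 1 ∷ 1 ∷ 2 ∷ 2 ∷ []) , 5) ∷
  ((2 ∷ 2 ∷ 2 ∷ 2 ∷ 3 ∷ 3 ∷ []) , 8) ∷ ((1 ∷ 1 ∷ 3 ∷ 3 ∷ 5 ∷ 8 ∷ []) , 14) ∷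
  ((1 ∷ 1 ∷ 3 ∷ 3 ∷ 5 ∷ 7 ∷ []) , 13) ∷ ((1 ∷ 2 ∷ 4 ∷ 4 ∷ 7 ∷ 9 ∷ []) , 17) ∷
  ((1 ∷ 1 ∷ 3 ∷ 3 ∷ 5 ∷ 6 ∷ []) , 12) ∷ ((1 ∷ 1 ∷ 3 ∷ 3 ∷ 5 ∷ 5 ∷ []) , 11) ∷
  ((1 ∷ 1 ∷ 2 ∷ 3 ∷ 4 ∷ 7 ∷ []) , 12) ∷ ((1 ∷ 1 ∷ 2 ∷ 3 ∷ 4 ∷ 6 ∷ []) , 11) ∷
  ((1 ∷ 2 ∷ 3 ∷ 4 ∷ 6 ∷ 8 ∷ []) , 15) ∷ ((1 ∷ 1 ∷ 2 ∷ 3 ∷ 4 ∷ 5 ∷ []) , 10) ∷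
  ((2 ∷ 2 ∷ 3 ∷ 5 ∷ 6 ∷ 7 ∷ []) , 15) ∷ ((1 ∷ 1 ∷ 3 ∷ 4 ∷ 5 ∷ 6 ∷ []) , 12) ∷
  ((1 ∷ 1 ∷ 2 ∷ 3 ∷ 4 ∷ 4 ∷ []) , 9) ∷ ((1 ∷ 1 ∷ 2 ∷ 2 ∷ 3 ∷ 6 ∷ []) , 10) ∷
  ((1 ∷ 1 ∷ 2 ∷ 2 ∷ 3 ∷ 5 ∷ []) , 9) ∷ ((1 ∷ 2 ∷ 3 ∷ 3 ∷ 5 ∷ 7 ∷ []) , 13) ∷
  ((1 ∷ 1 ∷ 2 ∷ 2 ∷ 3 ∷ 4 ∷ []) , 8) ∷ ((2 ∷ 2 ∷ 3 ∷ 4 ∷ 5 ∷ 6 ∷ []) , 13) ∷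
  ((2 ∷ 2 ∷ 3 ∷ 3 ∷ 4 ∷ 5 ∷ []) , 11) ∷ ((3 ∷ 3 ∷ 4 ∷ 4 ∷ 5 ∷ 6 ∷ []) , 14) ∷
  ((1 ∷ 1 ∷ 3 ∷ 3 ∷ 4 ∷ 5 ∷ []) , 10) ∷ ((2 ∷ 2 ∷ 4 ∷ 5 ∷ 6 ∷ 7 ∷ []) , 15) ∷
  ((1 ∷ 1 ∷ 2 ∷ 2 ∷ 3 ∷ 3 ∷ []) , 7) ∷ ((2 ∷ 2 ∷ 3 ∷ 3 ∷ 4 ∷ 4 ∷ []) , 10) ∷
  ((1 ∷ 2 ∷ 2 ∷ 4 ∷ 5 ∷ 9 ∷ []) , 15) ∷ ((1 ∷ 2 ∷ 2 ∷ 4 ∷ 5 ∷ 8 ∷ []) , 14) ∷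
  ((1 ∷ 2 ∷ 2 ∷ 4 ∷ 5 ∷ 7 ∷ []) , 13) ∷ ((1 ∷ 2 ∷ 3 ∷ 5 ∷ 6 ∷ 8 ∷ []) , 15) ∷
  ((1 ∷ 2 ∷ 2 ∷ 4 ∷ 5 ∷ 6 ∷ []) , 12) ∷ ((1 ∷ 2 ∷ 4 ∷ 6 ∷ 7 ∷ 9 ∷ []) , 17) ∷
  ((1 ∷ 2 ∷ 3 ∷ 5 ∷ 6 ∷ 7 ∷ []) , 14) ∷ ((1 ∷ 2 ∷ 2 ∷ 4 ∷ 5 ∷ 5 ∷ []) , 11) ∷
  ((1 ∷ 2 ∷ 2 ∷ 3 ∷ 4 ∷ 8 ∷ []) , 13) ∷ ((1 ∷ 2 ∷ 2 ∷ 3 ∷ 4 ∷ 7 ∷ []) , 12) ∷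
  ((1 ∷ 2 ∷ 2 ∷ 3 ∷ 4 ∷ 6 ∷ []) , 11) ∷ ((1 ∷ 2 ∷ 3 ∷ 4 ∷ 5 ∷ 7 ∷ []) , 13) ∷
  ((1 ∷ 2 ∷ 2 ∷ 3 ∷ 4 ∷ 5 ∷ []) , 10) ∷ ((2 ∷ 3 ∷ 3 ∷ 4 ∷ 5 ∷ 6 ∷ []) , 13) ∷
  ((3 ∷ 4 ∷ 4 ∷ 5 ∷ 6 ∷ 7 ∷ []) , 16) ∷ ((1 ∷ 2 ∷ 4 ∷ 5 ∷ 6 ∷ 8 ∷ []) , 15) ∷
  ((1 ∷ 2 ∷ 3 ∷ 4 ∷ 5 ∷ 6 ∷ []) , 12) ∷ ((2 ∷ 3 ∷ 4 ∷ 5 ∷ 6 ∷ 7 ∷ []) , 15) ∷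
  ((3 ∷ 4 ∷ 5 ∷ 6 ∷ 7 ∷ 8 ∷ []) , 18) ∷ ((1 ∷ 3 ∷ 3 ∷ 5 ∷ 6 ∷ 7 ∷ []) , 14) ∷
  ((1 ∷ 2 ∷ 2 ∷ 3 ∷ 4 ∷ 4 ∷ []) , 9) ∷ ((2 ∷ 3 ∷ 3 ∷ 4 ∷ 5 ∷ 5 ∷ []) , 12) ∷
  ((1 ∷ 2 ∷ 2 ∷ 2 ∷ 3 ∷ 7 ∷ []) , 11) ∷ ((1 ∷ 2 ∷ 2 ∷ 2 ∷ 3 ∷ 6 ∷ []) , 10) ∷
  ((1 ∷ 2 ∷ 2 ∷ 2 ∷ 3 ∷ 5 ∷ []) , 9) ∷ ((1 ∷ 2 ∷ 3 ∷ 3 ∷ 4 ∷ 6 ∷ []) , 11) ∷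
  ((1 ∷ 3 ∷ 3 ∷ 4 ∷ 5 ∷ 7 ∷ []) , 13) ∷ ((1 ∷ 2 ∷ 2 ∷ 2 ∷ 3 ∷ 4 ∷ []) , 8) ∷
  ((2 ∷ 3 ∷ 3 ∷ 3 ∷ 4 ∷ 5 ∷ []) , 11) ∷ ((1 ∷ 2 ∷ 4 ∷ 4 ∷ 5 ∷ 7 ∷ []) , 13) ∷
  ((1 ∷ 3 ∷ 4 ∷ 5 ∷ 6 ∷ 8 ∷ []) , 15) ∷ ((1 ∷ 2 ∷ 3 ∷ 3 ∷ 4 ∷ 5 ∷ []) , 10) ∷
  ((2 ∷ 3 ∷ 4 ∷ 4 ∷ 5 ∷ 6 ∷ []) , 13) ∷ ((1 ∷ 4 ∷ 4 ∷ 6 ∷ 7 ∷ 9 ∷ []) , 17) ∷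
  ((1 ∷ 3 ∷ 3 ∷ 4 ∷ 5 ∷ 6 ∷ []) , 12) ∷ ((2 ∷ 4 ∷ 4 ∷ 5 ∷ 6 ∷ 7 ∷ []) , 15) ∷
  ((1 ∷ 3 ∷ 3 ∷ 3 ∷ 5 ∷ 5 ∷ []) , 11) ∷ ((1 ∷ 2 ∷ 2 ∷ 2 ∷ 3 ∷ 3 ∷ []) , 7) ∷
  ((1 ∷ 1 ∷ 1 ∷ 3 ∷ 3 ∷ 6 ∷ []) , 10) ∷ ((1 ∷ 1 ∷ 1 ∷ 3 ∷ 3 ∷ 5 ∷ []) , 9) ∷
  ((1 ∷ 2 ∷ 2 ∷ 5 ∷ 5 ∷ 8 ∷ []) , 14) ∷ ((1 ∷ 1 ∷ 2 ∷ 4 ∷ 4 ∷ 6 ∷ []) , 11) ∷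
  ((1 ∷ 1 ∷ 1 ∷ 3 ∷ 3 ∷ 4 ∷ []) , 8) ∷ ((1 ∷ 1 ∷ 3 ∷ 5 ∷ 5 ∷ 7 ∷ []) , 13) ∷
  ((1 ∷ 1 ∷ 2 ∷ 4 ∷ 4 ∷ 5 ∷ []) , 10) ∷ ((1 ∷ 2 ∷ 2 ∷ 5 ∷ 5 ∷ 6 ∷ []) , 12) ∷
  ((1 ∷ 1 ∷ 1 ∷ 3 ∷ 3 ∷ 3 ∷ []) , 7) ∷ ((1 ∷ 1 ∷ 1 ∷ 2 ∷ 2 ∷ 5 ∷ []) , 8) ∷ ((1 ∷ 1 ∷ 1 ∷ 2 ∷ 2 ∷ 4 ∷ []) , 7) ∷
  ((1 ∷ 2 ∷ 2 ∷ 4 ∷ 4 ∷ 7 ∷ []) , 12) ∷ ((1 ∷ 1 ∷ 2 ∷ 3 ∷ 3 ∷ 5 ∷ []) , 9) ∷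
  ((1 ∷ 1 ∷ 1 ∷ 2 ∷ 2 ∷ 3 ∷ []) , 6) ∷ ((2 ∷ 2 ∷ 2 ∷ 3 ∷ 4 ∷ 5 ∷ []) , 10) ∷
  ((2 ∷ 2 ∷ 2 ∷ 3 ∷ 3 ∷ 4 ∷ []) , 9) ∷ ((1 ∷ 1 ∷ 3 ∷ 4 ∷ 4 ∷ 6 ∷ []) , 11) ∷
  ((1 ∷ 1 ∷ 2 ∷ 3 ∷ 3 ∷ 4 ∷ []) , 8) ∷ ((2 ∷ 2 ∷ 3 ∷ 4 ∷ 5 ∷ 6 ∷ []) , 12) ∷
  ((2 ∷ 2 ∷ 3 ∷ 4 ∷ 4 ∷ 5 ∷ []) , 11) ∷ ((1 ∷ 2 ∷ 2 ∷ 4 ∷ 4 ∷ 5 ∷ []) , 10) ∷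
  ((2 ∷ 3 ∷ 3 ∷ 5 ∷ 6 ∷ 7 ∷ []) , 14) ∷ ((2 ∷ 3 ∷ 3 ∷ 5 ∷ 5 ∷ 6 ∷ []) , 13) ∷
  ((2 ∷ 2 ∷ 2 ∷ 5 ∷ 5 ∷ 6 ∷ []) , 12) ∷ ((2 ∷ 2 ∷ 2 ∷ 4 ∷ 5 ∷ 5 ∷ []) , 11) ∷
  ((1 ∷ 1 ∷ 1 ∷ 2 ∷ 2 ∷ 2 ∷ []) , 5) ∷ ((1 ∷ 2 ∷ 2 ∷ 3 ∷ 3 ∷ 8 ∷ []) , 12) ∷
  ((1 ∷ 2 ∷ 2 ∷ 3 ∷ 3 ∷ 7 ∷ []) , 11) ∷ ((1 ∷ 2 ∷ 2 ∷ 3 ∷ 3 ∷ 6 ∷ []) , 10) ∷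
  ((1 ∷ 2 ∷ 3 ∷ 4 ∷ 4 ∷ 7 ∷ []) , 12) ∷ ((1 ∷ 2 ∷ 2 ∷ 3 ∷ 3 ∷ 5 ∷ []) , 9) ∷
  ((2 ∷ 3 ∷ 3 ∷ 4 ∷ 5 ∷ 7 ∷ []) , 13) ∷ ((2 ∷ 3 ∷ 3 ∷ 4 ∷ 4 ∷ 6 ∷ []) , 12) ∷
  ((1 ∷ 2 ∷ 4 ∷ 5 ∷ 5 ∷ 8 ∷ []) , 14) ∷ ((1 ∷ 2 ∷ 3 ∷ 4 ∷ 4 ∷ 6 ∷ []) , 11) ∷
  ((2 ∷ 3 ∷ 4 ∷ 5 ∷ 6 ∷ 8 ∷ []) , 15) ∷ ((2 ∷ 3 ∷ 4 ∷ 5 ∷ 5 ∷ 7 ∷ []) , 14) ∷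
  ((1 ∷ 3 ∷ 3 ∷ 5 ∷ 5 ∷ 7 ∷ []) , 13) ∷ ((2 ∷ 4 ∷ 4 ∷ 6 ∷ 7 ∷ 9 ∷ []) , 17) ∷
  ((1 ∷ 2 ∷ 2 ∷ 3 ∷ 3 ∷ 4 ∷ []) , 8) ∷ ((1 ∷ 1 ∷ 2 ∷ 2 ∷ 2 ∷ 6 ∷ []) , 9) ∷ ((1 ∷ 1 ∷ 2 ∷ 2 ∷ 2 ∷ 5 ∷ []) , 8) ∷
  ((1 ∷ 2 ∷ 3 ∷ 3 ∷ 3 ∷ 7 ∷ []) , 11) ∷ ((1 ∷ 1 ∷ 2 ∷ 2 ∷ 2 ∷ 4 ∷ []) , 7) ∷
  ((2 ∷ 2 ∷ 3 ∷ 4 ∷ 4 ∷ 7 ∷ []) , 12) ∷ ((2 ∷ 2 ∷ 3 ∷ 3 ∷ 4 ∷ 6 ∷ []) , 11) ∷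
  ((2 ∷ 2 ∷ 3 ∷ 3 ∷ 3 ∷ 5 ∷ []) , 10) ∷ ((1 ∷ 1 ∷ 3 ∷ 3 ∷ 3 ∷ 5 ∷ []) , 9) ∷
  ((2 ∷ 2 ∷ 4 ∷ 5 ∷ 5 ∷ 8 ∷ []) , 14) ∷ ((2 ∷ 2 ∷ 4 ∷ 4 ∷ 5 ∷ 7 ∷ []) , 13) ∷
  ((1 ∷ 1 ∷ 2 ∷ 2 ∷ 2 ∷ 3 ∷ []) , 6) ∷ ((1 ∷ 1 ∷ 1 ∷ 1 ∷ 1 ∷ 4 ∷ []) , 6) ∷ ((1 ∷ 1 ∷ 1 ∷ 1 ∷ 1 ∷ 3 ∷ []) , 5) ∷
  ((1 ∷ 2 ∷ 2 ∷ 2 ∷ 2 ∷ 5 ∷ []) , 8) ∷ ((2 ∷ 2 ∷ 3 ∷ 3 ∷ 3 ∷ 7 ∷ []) , 11) ∷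
  ((2 ∷ 2 ∷ 2 ∷ 3 ∷ 3 ∷ 6 ∷ []) , 10) ∷ ((2 ∷ 2 ∷ 2 ∷ 2 ∷ 3 ∷ 5 ∷ []) , 9) ∷
  ((1 ∷ 1 ∷ 1 ∷ 1 ∷ 1 ∷ 2 ∷ []) , 4) ∷ ((0 ∷ 0 ∷ 0 ∷ 0 ∷ 1 ∷ 1 ∷ []) , 2) ∷ ((1 ∷ 1 ∷ 1 ∷ 1 ∷ 4 ∷ 5 ∷ []) , 9) ∷
  ((1 ∷ 1 ∷ 1 ∷ 1 ∷ 4 ∷ 4 ∷ []) , 8) ∷ ((0 ∷ 1 ∷ 1 ∷ 1 ∷ 3 ∷ 4 ∷ []) , 7) ∷
  ((1 ∷ 2 ∷ 2 ∷ 2 ∷ 6 ∷ 7 ∷ []) , 13) ∷ ((0 ∷ 1 ∷ 1 ∷ 1 ∷ 3 ∷ 3 ∷ []) , 6) ∷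
  ((1 ∷ 1 ∷ 2 ∷ 2 ∷ 5 ∷ 7 ∷ []) , 12) ∷ ((1 ∷ 1 ∷ 2 ∷ 2 ∷ 5 ∷ 6 ∷ []) , 11) ∷
  ((1 ∷ 2 ∷ 3 ∷ 3 ∷ 7 ∷ 8 ∷ []) , 15) ∷ ((1 ∷ 1 ∷ 2 ∷ 2 ∷ 5 ∷ 5 ∷ []) , 10) ∷
  ((1 ∷ 1 ∷ 1 ∷ 2 ∷ 4 ∷ 6 ∷ []) , 10) ∷ ((1 ∷ 1 ∷ 1 ∷ 2 ∷ 4 ∷ 5 ∷ []) , 9) ∷
  ((1 ∷ 2 ∷ 2 ∷ 3 ∷ 6 ∷ 7 ∷ []) , 13) ∷ ((2 ∷ 2 ∷ 3 ∷ 4 ∷ 8 ∷ 9 ∷ []) , 17) ∷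
  ((1 ∷ 1 ∷ 1 ∷ 2 ∷ 4 ∷ 4 ∷ []) , 8) ∷ ((1 ∷ 1 ∷ 1 ∷ 1 ∷ 3 ∷ 5 ∷ []) , 8) ∷ ((1 ∷ 1 ∷ 1 ∷ 1 ∷ 3 ∷ 4 ∷ []) , 7) ∷
  ((1 ∷ 2 ∷ 2 ∷ 2 ∷ 5 ∷ 6 ∷ []) , 11) ∷ ((2 ∷ 2 ∷ 3 ∷ 3 ∷ 7 ∷ 8 ∷ []) , 15) ∷
  ((2 ∷ 2 ∷ 2 ∷ 3 ∷ 6 ∷ 7 ∷ []) , 13) ∷ ((1 ∷ 1 ∷ 1 ∷ 1 ∷ 3 ∷ 3 ∷ []) , 6) ∷
  ((0 ∷ 0 ∷ 1 ∷ 1 ∷ 2 ∷ 3 ∷ []) , 5) ∷ ((1 ∷ 1 ∷ 3 ∷ 3 ∷ 6 ∷ 8 ∷ []) , 14) ∷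
  ((0 ∷ 1 ∷ 2 ∷ 2 ∷ 4 ∷ 5 ∷ []) , 9) ∷ ((1 ∷ 1 ∷ 3 ∷ 3 ∷ 6 ∷ 7 ∷ []) , 13) ∷
  ((0 ∷ 0 ∷ 1 ∷ 1 ∷ 2 ∷ 2 ∷ []) , 4) ∷ ((1 ∷ 1 ∷ 2 ∷ 3 ∷ 5 ∷ 8 ∷ []) , 13) ∷
  ((1 ∷ 1 ∷ 2 ∷ 3 ∷ 5 ∷ 7 ∷ []) , 12) ∷ ((1 ∷ 2 ∷ 3 ∷ 4 ∷ 7 ∷ 9 ∷ []) , 16) ∷
  ((1 ∷ 1 ∷ 2 ∷ 3 ∷ 5 ∷ 6 ∷ []) , 11) ∷ ((2 ∷ 2 ∷ 3 ∷ 5 ∷ 8 ∷ 9 ∷ []) , 17) ∷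
  ((1 ∷ 1 ∷ 3 ∷ 4 ∷ 6 ∷ 7 ∷ []) , 13) ∷ ((1 ∷ 1 ∷ 2 ∷ 3 ∷ 5 ∷ 5 ∷ []) , 10) ∷
  ((1 ∷ 1 ∷ 2 ∷ 2 ∷ 4 ∷ 7 ∷ []) , 11) ∷ ((1 ∷ 1 ∷ 2 ∷ 2 ∷ 4 ∷ 6 ∷ []) , 10) ∷
  ((1 ∷ 2 ∷ 3 ∷ 3 ∷ 6 ∷ 8 ∷ []) , 14) ∷ ((1 ∷ 1 ∷ 2 ∷ 2 ∷ 4 ∷ 5 ∷ []) , 9) ∷
  ((2 ∷ 2 ∷ 3 ∷ 4 ∷ 7 ∷ 8 ∷ []) , 15) ∷ ((2 ∷ 2 ∷ 3 ∷ 3 ∷ 6 ∷ 7 ∷ []) , 13) ∷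
  ((1 ∷ 1 ∷ 3 ∷ 3 ∷ 5 ∷ 6 ∷ []) , 11) ∷ ((2 ∷ 2 ∷ 4 ∷ 5 ∷ 8 ∷ 9 ∷ []) , 17) ∷
  ((1 ∷ 1 ∷ 2 ∷ 2 ∷ 4 ∷ 4 ∷ []) , 8) ∷ ((0 ∷ 1 ∷ 1 ∷ 2 ∷ 3 ∷ 5 ∷ []) , 8) ∷
  ((1 ∷ 2 ∷ 2 ∷ 4 ∷ 6 ∷ 9 ∷ []) , 15) ∷ ((0 ∷ 1 ∷ 1 ∷ 2 ∷ 3 ∷ 4 ∷ []) , 7) ∷
  ((1 ∷ 2 ∷ 3 ∷ 5 ∷ 7 ∷ 9 ∷ []) , 16) ∷ ((1 ∷ 2 ∷ 2 ∷ 4 ∷ 6 ∷ 7 ∷ []) , 13) ∷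
  ((0 ∷ 1 ∷ 2 ∷ 3 ∷ 4 ∷ 5 ∷ []) , 9) ∷ ((1 ∷ 2 ∷ 3 ∷ 5 ∷ 7 ∷ 8 ∷ []) , 15) ∷
  ((0 ∷ 1 ∷ 1 ∷ 2 ∷ 3 ∷ 3 ∷ []) , 6) ∷ ((1 ∷ 2 ∷ 2 ∷ 3 ∷ 5 ∷ 9 ∷ []) , 14) ∷
  ((1 ∷ 2 ∷ 2 ∷ 3 ∷ 5 ∷ 8 ∷ []) , 13) ∷ ((1 ∷ 2 ∷ 2 ∷ 3 ∷ 5 ∷ 7 ∷ []) , 12) ∷
  ((1 ∷ 2 ∷ 3 ∷ 4 ∷ 6 ∷ 8 ∷ []) , 14) ∷ ((1 ∷ 2 ∷ 2 ∷ 3 ∷ 5 ∷ 6 ∷ []) , 11) ∷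
  ((2 ∷ 3 ∷ 3 ∷ 4 ∷ 7 ∷ 8 ∷ []) , 15) ∷ ((1 ∷ 2 ∷ 4 ∷ 5 ∷ 7 ∷ 9 ∷ []) , 16) ∷
  ((1 ∷ 2 ∷ 3 ∷ 4 ∷ 6 ∷ 7 ∷ []) , 13) ∷ ((2 ∷ 3 ∷ 4 ∷ 5 ∷ 8 ∷ 9 ∷ []) , 17) ∷
  ((1 ∷ 3 ∷ 3 ∷ 5 ∷ 7 ∷ 8 ∷ []) , 15) ∷ ((1 ∷ 2 ∷ 2 ∷ 3 ∷ 5 ∷ 5 ∷ []) , 10) ∷
  ((0 ∷ 1 ∷ 1 ∷ 1 ∷ 2 ∷ 4 ∷ []) , 6) ∷ ((1 ∷ 2 ∷ 2 ∷ 2 ∷ 4 ∷ 7 ∷ []) , 11) ∷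
  ((0 ∷ 1 ∷ 1 ∷ 1 ∷ 2 ∷ 3 ∷ []) , 5) ∷ ((1 ∷ 2 ∷ 3 ∷ 3 ∷ 5 ∷ 7 ∷ []) , 12) ∷
  ((1 ∷ 3 ∷ 3 ∷ 4 ∷ 6 ∷ 8 ∷ []) , 14) ∷ ((1 ∷ 2 ∷ 2 ∷ 2 ∷ 4 ∷ 5 ∷ []) , 9) ∷
  ((0 ∷ 1 ∷ 2 ∷ 2 ∷ 3 ∷ 4 ∷ []) , 7) ∷ ((1 ∷ 3 ∷ 4 ∷ 5 ∷ 7 ∷ 9 ∷ []) , 16) ∷
  ((1 ∷ 2 ∷ 3 ∷ 3 ∷ 5 ∷ 6 ∷ []) , 11) ∷ ((0 ∷ 2 ∷ 2 ∷ 3 ∷ 4 ∷ 5 ∷ []) , 9) ∷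
  ((1 ∷ 3 ∷ 3 ∷ 4 ∷ 6 ∷ 7 ∷ []) , 13) ∷ ((0 ∷ 1 ∷ 1 ∷ 1 ∷ 2 ∷ 2 ∷ []) , 4) ∷
  ((1 ∷ 1 ∷ 1 ∷ 3 ∷ 4 ∷ 7 ∷ []) , 11) ∷ ((1 ∷ 1 ∷ 1 ∷ 3 ∷ 4 ∷ 6 ∷ []) , 10) ∷
  ((1 ∷ 2 ∷ 2 ∷ 5 ∷ 6 ∷ 9 ∷ []) , 15) ∷ ((1 ∷ 1 ∷ 2 ∷ 4 ∷ 5 ∷ 7 ∷ []) , 12) ∷
  ((1 ∷ 1 ∷ 1 ∷ 3 ∷ 4 ∷ 5 ∷ []) , 9) ∷ ((1 ∷ 1 ∷ 3 ∷ 5 ∷ 6 ∷ 8 ∷ []) , 14) ∷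
  ((1 ∷ 1 ∷ 2 ∷ 4 ∷ 5 ∷ 6 ∷ []) , 11) ∷ ((1 ∷ 2 ∷ 2 ∷ 5 ∷ 6 ∷ 7 ∷ []) , 13) ∷
  ((1 ∷ 1 ∷ 1 ∷ 3 ∷ 4 ∷ 4 ∷ []) , 8) ∷ ((1 ∷ 1 ∷ 1 ∷ 2 ∷ 3 ∷ 6 ∷ []) , 9) ∷ ((1 ∷ 1 ∷ 1 ∷ 2 ∷ 3 ∷ 5 ∷ []) , 8) ∷
  ((1 ∷ 2 ∷ 2 ∷ 4 ∷ 5 ∷ 8 ∷ []) , 13) ∷ ((1 ∷ 1 ∷ 2 ∷ 3 ∷ 4 ∷ 6 ∷ []) , 10) ∷
  ((1 ∷ 1 ∷ 1 ∷ 2 ∷ 3 ∷ 4 ∷ []) , 7) ∷ ((2 ∷ 2 ∷ 2 ∷ 3 ∷ 5 ∷ 6 ∷ []) , 11) ∷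
  ((1 ∷ 1 ∷ 3 ∷ 4 ∷ 5 ∷ 7 ∷ []) , 12) ∷ ((1 ∷ 1 ∷ 2 ∷ 3 ∷ 4 ∷ 5 ∷ []) , 9) ∷
  ((2 ∷ 2 ∷ 3 ∷ 4 ∷ 6 ∷ 7 ∷ []) , 13) ∷ ((1 ∷ 2 ∷ 2 ∷ 4 ∷ 5 ∷ 6 ∷ []) , 11) ∷
  ((2 ∷ 3 ∷ 3 ∷ 5 ∷ 7 ∷ 8 ∷ []) , 15) ∷ ((2 ∷ 2 ∷ 2 ∷ 5 ∷ 6 ∷ 7 ∷ []) , 13) ∷
  ((1 ∷ 1 ∷ 1 ∷ 2 ∷ 3 ∷ 3 ∷ []) , 6) ∷ ((1 ∷ 2 ∷ 2 ∷ 3 ∷ 4 ∷ 9 ∷ []) , 13) ∷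
  ((1 ∷ 2 ∷ 2 ∷ 3 ∷ 4 ∷ 8 ∷ []) , 12) ∷ ((1 ∷ 2 ∷ 2 ∷ 3 ∷ 4 ∷ 7 ∷ []) , 11) ∷
  ((1 ∷ 2 ∷ 3 ∷ 4 ∷ 5 ∷ 8 ∷ []) , 13) ∷ ((1 ∷ 2 ∷ 2 ∷ 3 ∷ 4 ∷ 6 ∷ []) , 10) ∷
  ((2 ∷ 3 ∷ 3 ∷ 4 ∷ 6 ∷ 8 ∷ []) , 14) ∷ ((1 ∷ 2 ∷ 4 ∷ 5 ∷ 6 ∷ 9 ∷ []) , 15) ∷
  ((1 ∷ 2 ∷ 3 ∷ 4 ∷ 5 ∷ 7 ∷ []) , 12) ∷ ((2 ∷ 3 ∷ 4 ∷ 5 ∷ 7 ∷ 9 ∷ []) , 16) ∷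
  ((1 ∷ 3 ∷ 3 ∷ 5 ∷ 6 ∷ 8 ∷ []) , 14) ∷ ((1 ∷ 2 ∷ 2 ∷ 3 ∷ 4 ∷ 5 ∷ []) , 9) ∷
  ((1 ∷ 1 ∷ 2 ∷ 2 ∷ 3 ∷ 7 ∷ []) , 10) ∷ ((1 ∷ 1 ∷ 2 ∷ 2 ∷ 3 ∷ 6 ∷ []) , 9) ∷
  ((1 ∷ 2 ∷ 3 ∷ 3 ∷ 4 ∷ 8 ∷ []) , 12) ∷ ((1 ∷ 1 ∷ 2 ∷ 2 ∷ 3 ∷ 5 ∷ []) , 8) ∷
  ((2 ∷ 2 ∷ 3 ∷ 4 ∷ 5 ∷ 8 ∷ []) , 13) ∷ ((2 ∷ 2 ∷ 3 ∷ 3 ∷ 5 ∷ 7 ∷ []) , 12) ∷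
  ((1 ∷ 1 ∷ 3 ∷ 3 ∷ 4 ∷ 6 ∷ []) , 10) ∷ ((2 ∷ 2 ∷ 4 ∷ 5 ∷ 6 ∷ 9 ∷ []) , 15) ∷
  ((1 ∷ 1 ∷ 2 ∷ 2 ∷ 3 ∷ 4 ∷ []) , 7) ∷ ((1 ∷ 1 ∷ 1 ∷ 1 ∷ 2 ∷ 5 ∷ []) , 7) ∷ ((1 ∷ 1 ∷ 1 ∷ 1 ∷ 2 ∷ 4 ∷ []) , 6) ∷
  ((1 ∷ 2 ∷ 2 ∷ 2 ∷ 3 ∷ 6 ∷ []) , 9) ∷ ((2 ∷ 2 ∷ 3 ∷ 3 ∷ 4 ∷ 8 ∷ []) , 12) ∷
  ((2 ∷ 2 ∷ 2 ∷ 3 ∷ 4 ∷ 7 ∷ []) , 11) ∷ ((1 ∷ 1 ∷ 1 ∷ 1 ∷ 2 ∷ 3 ∷ []) , 5) ∷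
  ((0 ∷ 0 ∷ 0 ∷ 1 ∷ 1 ∷ 2 ∷ []) , 3) ∷ ((1 ∷ 1 ∷ 1 ∷ 4 ∷ 4 ∷ 7 ∷ []) , 11) ∷
  ((0 ∷ 1 ∷ 1 ∷ 3 ∷ 3 ∷ 5 ∷ []) , 8) ∷ ((1 ∷ 1 ∷ 2 ∷ 5 ∷ 5 ∷ 8 ∷ []) , 13) ∷
  ((1 ∷ 1 ∷ 1 ∷ 4 ∷ 4 ∷ 6 ∷ []) , 10) ∷ ((0 ∷ 0 ∷ 1 ∷ 2 ∷ 2 ∷ 3 ∷ []) , 5) ∷
  ((1 ∷ 1 ∷ 2 ∷ 5 ∷ 5 ∷ 7 ∷ []) , 12) ∷ ((0 ∷ 1 ∷ 1 ∷ 3 ∷ 3 ∷ 4 ∷ []) , 7) ∷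
  ((1 ∷ 1 ∷ 1 ∷ 4 ∷ 4 ∷ 5 ∷ []) , 9) ∷ ((0 ∷ 0 ∷ 0 ∷ 1 ∷ 1 ∷ 1 ∷ []) , 2) ∷
  ((1 ∷ 1 ∷ 1 ∷ 3 ∷ 3 ∷ 7 ∷ []) , 10) ∷ ((1 ∷ 1 ∷ 1 ∷ 3 ∷ 3 ∷ 6 ∷ []) , 9) ∷
  ((1 ∷ 2 ∷ 2 ∷ 5 ∷ 5 ∷ 9 ∷ []) , 14) ∷ ((1 ∷ 1 ∷ 2 ∷ 4 ∷ 4 ∷ 7 ∷ []) , 11) ∷
  ((1 ∷ 1 ∷ 1 ∷ 3 ∷ 3 ∷ 5 ∷ []) , 8) ∷ ((1 ∷ 1 ∷ 3 ∷ 5 ∷ 5 ∷ 8 ∷ []) , 13) ∷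
  ((1 ∷ 1 ∷ 2 ∷ 4 ∷ 4 ∷ 6 ∷ []) , 10) ∷ ((1 ∷ 2 ∷ 2 ∷ 5 ∷ 5 ∷ 7 ∷ []) , 12) ∷
  ((1 ∷ 1 ∷ 1 ∷ 3 ∷ 3 ∷ 4 ∷ []) , 7) ∷ ((0 ∷ 1 ∷ 1 ∷ 2 ∷ 2 ∷ 5 ∷ []) , 7) ∷
  ((1 ∷ 2 ∷ 2 ∷ 4 ∷ 4 ∷ 9 ∷ []) , 13) ∷ ((0 ∷ 1 ∷ 1 ∷ 2 ∷ 2 ∷ 4 ∷ []) , 6) ∷
  ((1 ∷ 2 ∷ 3 ∷ 5 ∷ 5 ∷ 9 ∷ []) , 14) ∷ ((1 ∷ 2 ∷ 2 ∷ 4 ∷ 4 ∷ 7 ∷ []) , 11) ∷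
  ((0 ∷ 1 ∷ 2 ∷ 3 ∷ 3 ∷ 5 ∷ []) , 8) ∷ ((1 ∷ 2 ∷ 3 ∷ 5 ∷ 5 ∷ 8 ∷ []) , 13) ∷
  ((0 ∷ 1 ∷ 1 ∷ 2 ∷ 2 ∷ 3 ∷ []) , 5) ∷ ((1 ∷ 1 ∷ 2 ∷ 3 ∷ 3 ∷ 8 ∷ []) , 11) ∷
  ((1 ∷ 1 ∷ 2 ∷ 3 ∷ 3 ∷ 7 ∷ []) , 10) ∷ ((1 ∷ 2 ∷ 3 ∷ 4 ∷ 4 ∷ 9 ∷ []) , 13) ∷
  ((1 ∷ 1 ∷ 2 ∷ 3 ∷ 3 ∷ 6 ∷ []) , 9) ∷ ((2 ∷ 2 ∷ 3 ∷ 5 ∷ 5 ∷ 9 ∷ []) , 14) ∷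
  ((1 ∷ 1 ∷ 3 ∷ 4 ∷ 4 ∷ 7 ∷ []) , 11) ∷ ((1 ∷ 1 ∷ 2 ∷ 3 ∷ 3 ∷ 5 ∷ []) , 8) ∷
  ((1 ∷ 1 ∷ 1 ∷ 2 ∷ 2 ∷ 6 ∷ []) , 8) ∷ ((1 ∷ 1 ∷ 1 ∷ 2 ∷ 2 ∷ 5 ∷ []) , 7) ∷
  ((1 ∷ 2 ∷ 2 ∷ 3 ∷ 3 ∷ 7 ∷ []) , 10) ∷ ((2 ∷ 2 ∷ 3 ∷ 4 ∷ 4 ∷ 9 ∷ []) , 13) ∷
  ((1 ∷ 1 ∷ 1 ∷ 2 ∷ 2 ∷ 4 ∷ []) , 6) ∷ ((0 ∷ 0 ∷ 1 ∷ 1 ∷ 1 ∷ 3 ∷ []) , 4) ∷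
  ((1 ∷ 1 ∷ 3 ∷ 3 ∷ 3 ∷ 8 ∷ []) , 11) ∷ ((0 ∷ 1 ∷ 2 ∷ 2 ∷ 2 ∷ 5 ∷ []) , 7) ∷
  ((1 ∷ 1 ∷ 3 ∷ 3 ∷ 3 ∷ 7 ∷ []) , 10) ∷ ((0 ∷ 0 ∷ 1 ∷ 1 ∷ 1 ∷ 2 ∷ []) , 3) ∷
  ((1 ∷ 1 ∷ 2 ∷ 2 ∷ 2 ∷ 7 ∷ []) , 9) ∷ ((1 ∷ 1 ∷ 2 ∷ 2 ∷ 2 ∷ 6 ∷ []) , 8) ∷
  ((1 ∷ 2 ∷ 3 ∷ 3 ∷ 3 ∷ 8 ∷ []) , 11) ∷ ((1 ∷ 1 ∷ 2 ∷ 2 ∷ 2 ∷ 5 ∷ []) , 7) ∷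
  ((0 ∷ 1 ∷ 1 ∷ 1 ∷ 1 ∷ 4 ∷ []) , 5) ∷ ((1 ∷ 2 ∷ 2 ∷ 2 ∷ 2 ∷ 7 ∷ []) , 9) ∷ ((0 ∷ 1 ∷ 1 ∷ 1 ∷ 1 ∷ 3 ∷ []) , 4) ∷
  ((1 ∷ 1 ∷ 1 ∷ 1 ∷ 1 ∷ 5 ∷ []) , 6) ∷ ((1 ∷ 1 ∷ 1 ∷ 1 ∷ 1 ∷ 4 ∷ []) , 5) ∷ ((0 ∷ 0 ∷ 0 ∷ 0 ∷ 0 ∷ 1 ∷ []) , 1) ∷
  []
weightCertificates _ = []

Pi⊆weighted-upTo6 : ∀ {n} → n ≤ 6 → ∀ v → InPi n v → IsWeighted v
Pi⊆weighted-upTo6 {0} _ = properLinear⇒weighted 0 (weightCertificates 0) tt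
Pi⊆weighted-upTo6 {1} _ = properLinear⇒weighted 1 (weightCertificates 1) tt
Pi⊆weighted-upTo6 {2} _ = properLinear⇒weighted 2 (weightCertificates 2) tt
Pi⊆weighted-upTo6 {3} _ = properLinear⇒weighted 3 (weightCertificates 3) tt
Pi⊆weighted-upTo6 {4} _ = properLinear⇒weighted 4 (weightCertificates 4) tt
Pi⊆weighted-upTo6 {5} _ = properLinear⇒weighted 5 (weightCertificates 5) tt
Pi⊆weighted-upTo6 {6} _ = properLinear⇒weighted 6 (weightCertificates 6) tt
Pi⊆weighted-upTo6 {suc (suc (suc (suc (suc (suc (suc _))))))} (s≤s (s≤s (s≤s (s≤s (s≤s (s≤s ()))))))

Jplus⊆proper-upTo5 : ∀ {n} → n ≤ 5 → ∀ v → InJplus n v → IsProper v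
Jplus⊆proper-upTo5 {0} _ = Jplus⇒proper-byEnumeration 0 tt
Jplus⊆proper-upTo5 {1} _ = Jplus⇒proper-byEnumeration 1 tt
Jplus⊆proper-upTo5 {2} _ = Jplus⇒proper-byEnumeration 2 tt
Jplus⊆proper-upTo5 {3} _ = Jplus⇒proper-byEnumeration 3 tt
Jplus⊆proper-upTo5 {4} _ = Jplus⇒proper-byEnumeration 4 tt
Jplus⊆proper-upTo5 {5} _ = Jplus⇒proper-byEnumeration 5 tt
Jplus⊆proper-upTo5 {suc (suc (suc (suc (suc (suc _)))))} (s≤s (s≤s (s≤s (s≤s (s≤s ())))))

Pi∖Wplus⇒7≤n : ∀ n → StrictlyLarger n (InWplus n) (InPi n) → 7 ≤ n
Pi∖Wplus⇒7≤n n (v , Pi , ¬Wplus) with 7 ℕ.≤? n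
... | yes 7≤n = 7≤n
... | no  7≰n =
  contradiction (Pi⊆weighted-upTo6 (ℕ.≤-pred (ℕ.≰⇒> 7≰n)) v Pi , proj₂ (Pi⊆Jplus n v Pi)) ¬Wplus

Jplus∖Pi⇒6≤n : ∀ n → StrictlyLarger n (InPi n) (InJplus n) → 6 ≤ n
Jplus∖Pi⇒6≤n n (v , Jplus , ¬Pi) with 6 ℕ.≤? n
... | yes 6≤n = 6≤n
... | no  6≰n = contradiction (proj₁ Jplus , Jplus⊆proper-upTo5 (ℕ.≤-pred (ℕ.≰⇒> 6≰n)) v Jplus) ¬Pi

-- Counterexamples

coalition : ∀ {n} → List ℕ → Subset n
coalition voters = tabulate λ i → any (suc (toℕ i) ≡ᵇ_) voters

generatedBy : ∀ {n} → List (Subset n) → Game n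
generatedBy generators S = any (λ G → isYes (S ≥M? G)) generators

counterexample₇ : Game 7
counterexample₇ = generatedBy (coalition (7 ∷ 6 ∷ 4 ∷ 1 ∷ []) ∷ coalition (7 ∷ 5 ∷ 3 ∷ 2 ∷ []) ∷ [])

Pi∖Wplus₇ : StrictlyLarger 7 (InWplus 7) (InPi 7)
Pi∖Wplus₇ = counterexample₇ , (linear , checkProper-sound counterexample₇ tt) ,
  λ (weighted , _) → trade⇒¬weighted
    {A₁ = coalition (7 ∷ 6 ∷ 4 ∷ 1 ∷ [])} {coalition (7 ∷ 5 ∷ 3 ∷ 2 ∷ [])}
    {coalition (7 ∷ 6 ∷ 5 ∷ [])} {coalition (7 ∷ 4 ∷ 3 ∷ 2 ∷ 1 ∷ [])}
    refl refl refl refl refl refl weighted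
  where
  linear : IsLinear counterexample₇
  linear = checkLinear-sound counterexample₇ tt

counterexample₆ : Game 6
counterexample₆ = generatedBy (coalition (6 ∷ 2 ∷ 1 ∷ []) ∷ coalition (5 ∷ 4 ∷ 3 ∷ []) ∷ [])

Jplus∖Pi₆ : StrictlyLarger 6 (InPi 6) (InJplus 6)
Jplus∖Pi₆ = counterexample₆ , (checkLinear-sound counterexample₆ tt , ℕ.≤ᵇ⇒≤ 32 _ tt) ,
  λ (_ , proper) → proper (coalition (5 ∷ 4 ∷ 3 ∷ [])) (refl , refl)

theorem3p8 : (n : ℕ) → 1 ≤ n →
    ((v : Game n) → InWplus n v → InPi n v) ×
    ((v : Game n) → InPi n v → InJplus n v) ×
    (StrictlyLarger n (InWplus n) (InPi n) ⇔ 7 ≤ n) ×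
    (StrictlyLarger n (InPi n) (InJplus n) ⇔ 6 ≤ n)
theorem3p8 n _ =
  Wplus⊆Pi n ,
  Pi⊆Jplus n ,
  mk⇔ (Pi∖Wplus⇒7≤n n) (ascend {λ n → StrictlyLarger n (InWplus n) (InPi n)} Pi∖Wplus₇ Pi∖Wplus-ascends) ,
  mk⇔ (Jplus∖Pi⇒6≤n n) (ascend {λ n → StrictlyLarger n (InPi n) (InJplus n)} Jplus∖Pi₆ Jplus∖Pi-ascends)
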